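{- Let $M$ be a loopless matroid of rank $r+1$ and let $\hat0\subsetneq F_1\subsetneq F_2\subsetneq\cdots\subsetneq F_\ell\subsetneq E$ be a chain of flats. Then for all $\mathbf{t}\in\mathbb{R}^{\mathcal{P}(M)}$, \[D_{F_1}\cdots D_{F_\ell}V_M(\mathbf{t})=V_{M^{F_1}}(\pi^{F_1}(\mathbf{t}))\,V_{M_{F_1}^{F_2}}(\pi_{F_1}^{F_2}(\mathbf{t}))\cdots V_{M_{F_{\ell-1}}^{F_\ell}}(\pi_{F_{\ell-1}}^{F_\ell}(\mathbf{t}))\,V_{M_{F_\ell}}(\pi_{F_\ell}(\mathbf{t})).\] In particular, if the chain is maximal (so $\ell=r$), then $D_{F_1}\cdots D_{F_r}V_M=1$.
   Context: A matroid $M$ on a finite set $E$ is a collection $\mathcal{L}(M)$ of subsets of $E$ (flats) such that (F1) $E$ is a flat; (F2) intersections of flats are flats; (F3) for every flat $F$, the sets $F_j\setminus F$, for $F_j$ ranging over the minimal flats properly containing $F$, partition $E\setminus F$. $\hat0$ is the intersection of all flats, $\hat1=E$; $M$ is loopless if $\hat0=\emptyset$. $\operatorname{rank}(F)$ is the (well-defined) length of a maximal chain of flats from $\hat0$ to $F$; $\operatorname{rank}(M)=\operatorname{rank}(E)$. $\mathcal{P}(M)=\mathcal{L}(M)\setminus\{\hat0,\hat1\}$. For flats $F\subseteq G$, $M_F^G$ is the matroid on $G\setminus F$ with flats $H\setminus F$ for flats $F\subseteq H\subseteq G$; $M^G=M^G_{\hat0}$, $M_F=M_F^E$. For loopless $M$: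 $\mathbb{R}^{\mathcal{P}(M)}$ has basis $\delta_F$ and coordinates $t_F$; $\alpha_i=\sum_{F\in\mathcal{P}(M),F\ni i}\delta_F$, $\beta_i=\sum_{F\in\mathcal{P}(M),F\not\ni i}\delta_F$; $W_M=\operatorname{span}\{\alpha_i-\alpha_j\}$, $L_M=\mathbb{R}^{\mathcal{P}(M)}/W_M$, with $\alpha,\beta$ the images of $\alpha_i,\beta_i$. For $F\in\mathcal{P}(M)$, $\pi^F:\mathbb{R}^{\mathcal{P}(M)}\to L_{M^F}$ sends $\delta_G\mapsto\delta_G$ ($G\subsetneq F$), $-\alpha$ ($G=F$), $0$ otherwise; $\pi_F:\mathbb{R}^{\mathcal{P}(M)}\to L_{M_F}$ sends $\delta_G\mapsto\delta_{G\setminus F}$ ($G\supsetneq F$), $-\beta$ ($G=F$), $0$ otherwise; both factor through $L_M$. For flats $F\subsetneq G$ in $\mathcal{P}(M)$, $\pi_F^G:L_M\to L_{M_F^G}$ denotes the composite of $\pi_F:L_M\to L_{M_F}$ with the map $\pi^{G\setminus F}:L_{M_F}\to L_{(M_F)^{G\setminus F}}=L_{M_F^G}$ (equivalently, of $\pi^G$ followed by $\pi_F$ on $M^G$). The volume polynomial $V_M$ is the unique polynomial function on $\mathbb{R}^{\mathcal{P}(M)}$ (for every loopless $M$ of rank $\geq1$) with $V_M=1$ in rank 1, $V_M(0)=0$ in rank $>1$, and $D_FV_M(\mathbf{t}):=\partial V_M/\partial t_F(\mathbf{t})=V_{M^F}(\pi^F\mathbf{t})V_{M_F}(\pi_F\mathbf{t})$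 for $F\in\mathcal{P}(M)$, each $V_{M'}$ being constant on cosets of $W_{M'}$ and hence regarded as a function on $L_{M'}$.
   Formalization: The points $\mathbf{t}$ have rational coordinates instead of ranging over all of $\mathbb{R}^{\mathcal{P}(M)}$, and the volume polynomials have rational coefficients. -}

module Defs where

open import Data.Nat using (ℕ; zero; suc)
open import Data.Bool using (Bool; true; false; _∧_; _∨_; not; if_then_else_)
import Data.Fin
open import Data.Fin using (Fin)
open import Data.Fin.Subset using (Subset; _∈_; _∉_; _⊆_; _⊂_; _∩_; _∪_; _─_; ⊥)
open import Data.Vec using (Vec; []; _∷_; lookup)
open import Data.List using (List; []; _∷_; _++_; map; filterᵇ; foldr)
open import Data.Maybe using (Maybe; just; nothing)
open import Data.Rational using (ℚ; 0ℚ; 1ℚ; _+_; _*_; -_)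
open import Data.Product using (_×_; Σ; ∃; ∃-syntax)
open import Relation.Binary.PropositionalEquality using (_≡_)

eqᵇ : ∀ {n} → Subset n → Subset n → Bool
eqᵇ [] [] = true
eqᵇ (true ∷ xs) (true ∷ ys) = eqᵇ xs ys
eqᵇ (false ∷ xs) (false ∷ ys) = eqᵇ xs ys
eqᵇ (true ∷ xs) (false ∷ ys) = false
eqᵇ (false ∷ xs) (true ∷ ys) = false

⊆ᵇ : ∀ {n} → Subset n → Subset n → Bool
⊆ᵇ [] [] = true
⊆ᵇ (true ∷ xs) (false ∷ ys) = false
⊆ᵇ (true ∷ xs) (true ∷ ys) = ⊆ᵇ xs ys
⊆ᵇ (false ∷ xs) (_ ∷ ys) = ⊆ᵇ xs ys

⊊ᵇ : ∀ {n} → Subset n → Subset n → Bool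
⊊ᵇ X Y = ⊆ᵇ X Y ∧ not (eqᵇ X Y)

pick : ∀ {n} → Subset n → Maybe (Fin n)
pick [] = nothing
pick (true ∷ xs) = just Data.Fin.zero
pick (false ∷ xs) with pick xs
... | just i = just (Data.Fin.suc i)
... | nothing = nothing

allSubsets : ∀ n → List (Subset n)
allSubsets zero = [] ∷ []
allSubsets (suc n) = map (true ∷_) (allSubsets n) ++ map (false ∷_) (allSubsets n)

record RawMat (n : ℕ) : Set where
  field
    ground : Subset n
    flat   : Subset n → Bool
open RawMat public

IsFlat : ∀ {n} → RawMat n → Subset n → Set
IsFlat M X = flat M X ≡ true

Covers : ∀ {n} → RawMat n → Subset n → Subset n → Set
Covers M F G = IsFlat M G × F ⊂ G ×
  (∀ H → IsFlat M H → F ⊂ H → H ⊆ G → H ≡ G)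

record IsMatroid {n} (M : RawMat n) : Set where
  field
    flat⊆ground : ∀ X → IsFlat M X → X ⊆ ground M
    F1 : IsFlat M (ground M)
    F2 : ∀ X Y → IsFlat M X → IsFlat M Y → IsFlat M (X ∩ Y)
    -- (F3): the sets G ∖ F, G ranging over covers of F, partition E ∖ F,
    -- i.e. every x ∈ E ∖ F lies in exactly one cover of F
    F3-exists : ∀ F → IsFlat M F → ∀ x → x ∈ ground M → x ∉ F →
      ∃[ G ] (Covers M F G × x ∈ G)
    F3-unique : ∀ F → IsFlat M F → ∀ x → x ∈ ground M → x ∉ F →
      ∀ G G' → Covers M F G → Covers M F G' → x ∈ G → x ∈ G' → G ≡ G'

flats : ∀ {n} → RawMat n → List (Subset n)
flats {n} M = filterᵇ (flat M) (allSubsets n)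

hat0 : ∀ {n} → RawMat n → Subset n
hat0 M = foldr _∩_ (ground M) (flats M)

Loopless : ∀ {n} → RawMat n → Set
Loopless M = hat0 M ≡ ⊥

inPᵇ : ∀ {n} → RawMat n → Subset n → Bool
inPᵇ M X = flat M X ∧ not (eqᵇ X (hat0 M)) ∧ not (eqᵇ X (ground M))

InP : ∀ {n} → RawMat n → Subset n → Set
InP M X = inPᵇ M X ≡ true

Plist : ∀ {n} → RawMat n → List (Subset n)
Plist {n} M = filterᵇ (inPᵇ M) (allSubsets n)

data CoverChain {n} (M : RawMat n) : Subset n → Subset n → ℕ → Set where
  here : ∀ F → CoverChain M F F zero
  step : ∀ {F G H k} → Covers M F G → CoverChain M G H k → CoverChain M F H (suc k)

HasRank : ∀ {n} → RawMat n → ℕ → Set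
HasRank M r = CoverChain M (hat0 M) (ground M) r

-- minors: M^G (restriction to the flat G) and M_F (contraction of the flat F)
restr : ∀ {n} → RawMat n → Subset n → RawMat n
restr M G = record { ground = G ; flat = λ X → flat M X ∧ ⊆ᵇ X G }

-- flats of M_F are H ∖ F for flats H ⊇ F, i.e. the X ⊆ E ∖ F with X ∪ F a flat
contr : ∀ {n} → RawMat n → Subset n → RawMat n
contr M F = record { ground = ground M ─ F
                   ; flat = λ X → flat M (X ∪ F) ∧ ⊆ᵇ X (ground M ─ F) }

-- M_F^G = (M_F)^{G∖F}
minor : ∀ {n} → RawMat n → Subset n → Subset n → RawMat n
minor M F G = restr (contr M F) (G ─ F)

-- Vectors of ℚ^{𝒫(M)} are functions Subset n → ℚ (only the coordinates
-- indexed by 𝒫(M) are relevant).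

Vect : ℕ → Set
Vect n = Subset n → ℚ

δ : ∀ {n} → Subset n → Vect n
δ G X = if eqᵇ G X then 1ℚ else 0ℚ

zeroV : ∀ {n} → Vect n
zeroV _ = 0ℚ

negV : ∀ {n} → Vect n → Vect n
negV v X = - v X

lincomb : ∀ {n} → List (Subset n) → Vect n → (Subset n → Vect n) → Vect n
lincomb [] t f X = 0ℚ
lincomb (G ∷ Gs) t f X = t G * f G X + lincomb Gs t f X

αv : ∀ {n} → RawMat n → Fin n → Vect n
αv M i X = if inPᵇ M X ∧ lookup X i then 1ℚ else 0ℚ

βv : ∀ {n} → RawMat n → Fin n → Vect n
βv M i X = if inPᵇ M X ∧ not (lookup X i) then 1ℚ else 0ℚ

-- representatives of α, β ∈ L_M (using the least element of the ground set)
αL : ∀ {n} → RawMat n → Vect n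
αL M with pick (ground M)
... | just i = αv M i
... | nothing = zeroV

βL : ∀ {n} → RawMat n → Vect n
βL M with pick (ground M)
... | just i = βv M i
... | nothing = zeroV

imgUp : ∀ {n} → RawMat n → Subset n → Subset n → Vect n
imgUp M F G = if ⊊ᵇ G F then δ G
              else (if eqᵇ G F then negV (αL (restr M F)) else zeroV)

πUp : ∀ {n} → RawMat n → Subset n → Vect n → Vect n
πUp M F t = lincomb (Plist M) t (imgUp M F)

imgDown : ∀ {n} → RawMat n → Subset n → Subset n → Vect n
imgDown M F G = if ⊊ᵇ F G then δ (G ─ F)
                else (if eqᵇ G F then negV (βL (contr M F)) else zeroV)

πDown : ∀ {n} → RawMat n → Subset n → Vect n → Vect n
πDown M F t = lincomb (Plist M) t (imgDown M F)

πMid : ∀ {n} → RawMat n → Subset n → Subset n → Vect n → Vect n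
πMid M F G t = πUp (contr M F) (G ─ F) (πDown M F t)

data Poly (n : ℕ) : Set where
  con : ℚ → Poly n
  var : Subset n → Poly n
  _⊕_ : Poly n → Poly n → Poly n
  _⊗_ : Poly n → Poly n → Poly n

eval : ∀ {n} → Vect n → Poly n → ℚ
eval t (con c) = c
eval t (var X) = t X
eval t (p ⊕ q) = eval t p + eval t q
eval t (p ⊗ q) = eval t p * eval t q

∂ : ∀ {n} → Subset n → Poly n → Poly n
∂ F (con c) = con 0ℚ
∂ F (var X) = if eqᵇ F X then con 1ℚ else con 0ℚ
∂ F (p ⊕ q) = ∂ F p ⊕ ∂ F q
∂ F (p ⊗ q) = (∂ F p ⊗ q) ⊕ (p ⊗ ∂ F q)

-- a polynomial regarded as a function on ℝ^{𝒫(M)}: coordinates outside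
-- 𝒫(M) are set to 0
restrictV : ∀ {n} → RawMat n → Vect n → Vect n
restrictV M t X = if inPᵇ M X then t X else 0ℚ

evalOn : ∀ {n} → RawMat n → Poly n → Vect n → ℚ
evalOn M p t = eval (restrictV M t) p

IsVolumeFamily : ∀ {n} → (RawMat n → Poly n) → Set
IsVolumeFamily {n} V = ∀ (M : RawMat n) → IsMatroid M → Loopless M →
  (HasRank M 1 → ∀ t → evalOn M (V M) t ≡ 1ℚ) ×
  (∀ r → HasRank M (suc (suc r)) → evalOn M (V M) zeroV ≡ 0ℚ) ×
  (∀ r → HasRank M (suc r) → ∀ F → InP M F → ∀ t →
     evalOn M (∂ F (V M)) t ≡
       evalOn (restr M F) (V (restr M F)) (πUp M F t)
       * evalOn (contr M F) (V (contr M F)) (πDown M F t))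

-- Chains 0̂ ⊊ F₁ ⊊ ⋯ ⊊ F_ℓ ⊊ E of flats, given as F₁ and [F₂,…,F_ℓ].

ChainFrom : ∀ {n} → RawMat n → Subset n → List (Subset n) → Set
ChainFrom M F [] = IsFlat M F × F ⊂ ground M
ChainFrom M F (G ∷ Gs) = IsFlat M F × F ⊂ G × ChainFrom M G Gs

IsChain : ∀ {n} → RawMat n → Subset n → List (Subset n) → Set
IsChain M F Fs = hat0 M ⊂ F × ChainFrom M F Fs

MaxFrom : ∀ {n} → RawMat n → Subset n → List (Subset n) → Set
MaxFrom M F [] = Covers M F (ground M)
MaxFrom M F (G ∷ Gs) = Covers M F G × MaxFrom M G Gs

IsMaximalChain : ∀ {n} → RawMat n → Subset n → List (Subset n) → Set
IsMaximalChain M F Fs = Covers M (hat0 M) F × MaxFrom M F Fs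

iterD : ∀ {n} → List (Subset n) → Poly n → Poly n
iterD Gs p = foldr ∂ p Gs

rhsFrom : ∀ {n} → (RawMat n → Poly n) → RawMat n → Subset n → List (Subset n) → Vect n → ℚ
rhsFrom V M F [] t = evalOn (contr M F) (V (contr M F)) (πDown M F t)
rhsFrom V M F (G ∷ Gs) t =
  evalOn (minor M F G) (V (minor M F G)) (πMid M F G t) * rhsFrom V M G Gs t

rhs : ∀ {n} → (RawMat n → Poly n) → RawMat n → Subset n → List (Subset n) → Vect n → ℚ
rhs V M F Fs t = evalOn (restr M F) (V (restr M F)) (πUp M F t) * rhsFrom V M F Fs t

lhs : ∀ {n} → (RawMat n → Poly n) → RawMat n → Subset n → List (Subset n) → Vect n → ℚ
lhs V M F Fs t = evalOn M (iterD (F ∷ Fs) (V M)) t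

{-# OPTIONS --safe #-}
-- Partial derivatives commute, so D_{F₁}⋯D_{F_ℓ} V_M = D_{F₂}⋯D_{F_ℓ} (D_{F₁} V_M), and by the axiom
-- D_{F₁} V_M = (V_{M^{F₁}} ∘ π^{F₁}) · (V_{M_{F₁}} ∘ π_{F₁}). The first factor is constant in the directions
-- δ_{F_i} (i ≥ 2), and π_{F₁} sends δ_{F_i} to δ_{F_i ∖ F₁}, so by the chain rule what remains is
-- D_{F₂∖F₁}⋯D_{F_ℓ∖F₁} V_{M_{F₁}} at π_{F₁} t; induction on ℓ in M_{F₁} applies. Its answer is the claimed
-- product because contracting F₁ and then F_i ∖ F₁ is contracting F_i, and π_{F_i∖F₁} ∘ π_{F₁} = π_{F_i}
-- on 𝒫(M_{F_i}): in coordinates (π_K t)_X = t_{X∪K} - t_K β_X, and the β-terms cancel.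
--
-- The axioms pin V down only through the values of its partials, so two facts about polynomials over ℚ are
-- used: a polynomial vanishing everywhere has vanishing partials (restrict to a line; a univariate
-- polynomial with infinitely many roots is zero), and one with vanishing gradient is constant. The latter
-- shows by induction that V_N, as a function, depends only on the flats of N, which identifies the iterated
-- minors with those of the statement. For a maximal chain every factor is V of a rank-1 matroid, i.e. 1.
module Submission where

open import Defs
open import Level using (0ℓ)
open import Function using (_∘_; Equivalence)
open import Data.Nat as ℕ using (ℕ; zero; suc; s≤s)
import Data.Nat.Properties as ℕ
open import Data.Bool using (Bool; true; false; if_then_else_; _∧_; _∨_; not; T; T?)
open import Data.Bool.Properties
  using (∧-zeroʳ; ∨-identityʳ; ∧-conicalˡ; ∧-conicalʳ; T-≡)
import Data.Bool.Properties as Bool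
open import Data.Sum using (inj₁; inj₂)
open import Data.Product using (_×_; _,_; proj₁; proj₂; ∃-syntax)
open import Data.Maybe using (Maybe; just; nothing)
open import Data.List using (List; []; _∷_; length; map; foldr; _++_; filterᵇ)
open import Data.List.Properties using (length-map; filter-≐)
open import Data.List.Relation.Unary.All using (All; []; _∷_)
import Data.List.Relation.Unary.All as All
open import Data.List.Relation.Unary.Any using (here; there)
open import Data.List.Membership.Propositional using () renaming (_∈_ to _∈ˡ_; _∉_ to _∉ˡ_)
open import Data.List.Membership.Propositional.Properties
  using (∈-++⁺ˡ; ∈-++⁺ʳ; ∈-map⁺; ∈-filter⁺; ∈-filter⁻)
open import Data.Vec using ([]; _∷_; lookup; here; there)
open import Data.Vec.Properties using (lookup-zipWith; []=⇒lookup; lookup⇒[]=)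
import Data.Vec.Properties as Vec
open import Data.Fin using (zero; suc)
open import Data.Fin.Subset using (Subset; _∈_; _∉_; _⊆_; _⊂_; _∩_; _∪_; _─_; ⊥; ∣_∣; Nonempty)
open import Data.Fin.Subset.Properties
  using (_∈?_; nonempty?; ∉⊥; ⊥⊆; ⊆-refl; ⊆-trans; ⊆-antisym; drop-∷-⊆; p⊂q⇒p⊆q; ⊂-irref; ⊂-trans;
         ⊂-⊆-trans; p⊆p∪q; q⊆p∪q; x∈p∪q⁺; x∈p∪q⁻; p∩q⊆p; p∩q⊆q; x∈p∩q⁺;
         p─q⊆p; x∈p∧x∉q⇒x∈p─q; ∪-assoc; ∪-identityˡ; ∩-zeroˡ; ∩-zeroʳ; ∪-distribʳ-∩;
         p⊂q⇒∣p∣<∣q∣; ∣p∣≤n; p∩q≢∅⇒∣p─q∣<∣p∣)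
open import Data.Rational using (ℚ; NonZero; 0ℚ; 1ℚ; _+_; _*_; -_; _-_; _<_; 1/_)
open import Data.Rational.Properties
  using (+-*-commutativeRing; +-0-group; _≟_; <⇒≢; <-trans; positive⁻¹; +-monoʳ-<; *-inverseˡ;
         +-identityˡ; +-identityʳ; *-identityˡ; *-zeroˡ; *-zeroʳ; *-assoc; +-assoc;
         *-distribˡ-+; *-distribʳ-+)
open import Data.Rational.Base using (≢-nonZero)
open import Algebra.Properties.Group +-0-group using (x∙y⁻¹≈ε⇒x≈y; x≈y⇒x∙y⁻¹≈ε)
open import Relation.Binary.PropositionalEquality
open import Relation.Nullary using (¬_; yes; no; contradiction)
open import Tactic.RingSolver using (solve-∀)
open import Tactic.RingSolver.Core.AlmostCommutativeRing using (AlmostCommutativeRing; fromCommutativeRing)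
open ≡-Reasoning

private
  variable
    n : ℕ

ℚ-ring : AlmostCommutativeRing 0ℓ 0ℓ
ℚ-ring = fromCommutativeRing +-*-commutativeRing isZero
  where
  isZero : ∀ x → Maybe (0ℚ ≡ x)
  isZero x with 0ℚ ≟ x
  ... | yes 0≡x = just 0≡x
  ... | no _ = nothing

p*q≡0⇒p≢0⇒q≡0 : ∀ p q → p * q ≡ 0ℚ → p ≢ 0ℚ → q ≡ 0ℚ
p*q≡0⇒p≢0⇒q≡0 p q pq≡0 p≢0 = begin
  q               ≡⟨ sym (*-identityˡ q) ⟩
  1ℚ * q          ≡⟨ cong (_* q) (sym (*-inverseˡ p)) ⟩
  (1/ p * p) * q  ≡⟨ *-assoc (1/ p) p q ⟩
  1/ p * (p * q)  ≡⟨ cong (1/ p *_) pq≡0 ⟩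
  1/ p * 0ℚ       ≡⟨ *-zeroʳ (1/ p) ⟩
  0ℚ              ∎
  where
  instance
    p-nonZero : NonZero p
    p-nonZero = ≢-nonZero p≢0

p-q≡0⇒p≡q : ∀ p q → p - q ≡ 0ℚ → p ≡ q
p-q≡0⇒p≡q = x∙y⁻¹≈ε⇒x≈y

p≡q⇒p-q≡0 : ∀ {p q} → p ≡ q → p - q ≡ 0ℚ
p≡q⇒p-q≡0 = x≈y⇒x∙y⁻¹≈ε

p<p+1 : ∀ p → p < p + 1ℚ
p<p+1 p = subst (_< p + 1ℚ) (+-identityʳ p) (+-monoʳ-< p (positive⁻¹ 1ℚ))

-- Univariate polynomials as coefficient lists [a₀, a₁, …]

⟦_⟧ : List ℚ → ℚ → ℚ
⟦ [] ⟧ x = 0ℚ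
⟦ a ∷ as ⟧ x = a + x * ⟦ as ⟧ x

infixl 6 _+ᶜ_
infixl 7 _*ᶜ_ _·ᶜ_

_+ᶜ_ : List ℚ → List ℚ → List ℚ
[] +ᶜ bs = bs
(a ∷ as) +ᶜ [] = a ∷ as
(a ∷ as) +ᶜ (b ∷ bs) = (a + b) ∷ (as +ᶜ bs)

_·ᶜ_ : ℚ → List ℚ → List ℚ
c ·ᶜ [] = []
c ·ᶜ (a ∷ as) = c * a ∷ c ·ᶜ as

_*ᶜ_ : List ℚ → List ℚ → List ℚ
[] *ᶜ bs = []
(a ∷ as) *ᶜ bs = a ·ᶜ bs +ᶜ (0ℚ ∷ as *ᶜ bs)

derivFrom : ℚ → List ℚ → List ℚ
derivFrom k [] = []
derivFrom k (a ∷ as) = k * a ∷ derivFrom (k + 1ℚ) as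

deriv : List ℚ → List ℚ
deriv [] = []
deriv (a ∷ as) = derivFrom 1ℚ as

⟦+ᶜ⟧ : ∀ as bs x → ⟦ as +ᶜ bs ⟧ x ≡ ⟦ as ⟧ x + ⟦ bs ⟧ x
⟦+ᶜ⟧ [] bs x = sym (+-identityˡ _)
⟦+ᶜ⟧ (a ∷ as) [] x = sym (+-identityʳ _)
⟦+ᶜ⟧ (a ∷ as) (b ∷ bs) x =
  trans (cong (λ v → (a + b) + x * v) (⟦+ᶜ⟧ as bs x)) (ring a b x (⟦ as ⟧ x) (⟦ bs ⟧ x))
  where
  ring : ∀ a b x u v → (a + b) + x * (u + v) ≡ (a + x * u) + (b + x * v)
  ring = solve-∀ ℚ-ring

⟦·ᶜ⟧ : ∀ c as x → ⟦ c ·ᶜ as ⟧ x ≡ c * ⟦ as ⟧ x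
⟦·ᶜ⟧ c [] x = sym (*-zeroʳ c)
⟦·ᶜ⟧ c (a ∷ as) x = trans (cong (λ v → c * a + x * v) (⟦·ᶜ⟧ c as x)) (ring c a x (⟦ as ⟧ x))
  where
  ring : ∀ c a x u → c * a + x * (c * u) ≡ c * (a + x * u)
  ring = solve-∀ ℚ-ring

⟦*ᶜ⟧ : ∀ as bs x → ⟦ as *ᶜ bs ⟧ x ≡ ⟦ as ⟧ x * ⟦ bs ⟧ x
⟦*ᶜ⟧ [] bs x = sym (*-zeroˡ (⟦ bs ⟧ x))
⟦*ᶜ⟧ (a ∷ as) bs x = begin
  ⟦ a ·ᶜ bs +ᶜ (0ℚ ∷ as *ᶜ bs) ⟧ x              ≡⟨ ⟦+ᶜ⟧ (a ·ᶜ bs) (0ℚ ∷ as *ᶜ bs) x ⟩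
  ⟦ a ·ᶜ bs ⟧ x + (0ℚ + x * ⟦ as *ᶜ bs ⟧ x)    ≡⟨ cong₂ (λ u v → u + (0ℚ + x * v)) (⟦·ᶜ⟧ a bs x) (⟦*ᶜ⟧ as bs x) ⟩
  a * ⟦ bs ⟧ x + (0ℚ + x * (⟦ as ⟧ x * ⟦ bs ⟧ x)) ≡⟨ ring a x (⟦ as ⟧ x) (⟦ bs ⟧ x) ⟩
  (a + x * ⟦ as ⟧ x) * ⟦ bs ⟧ x                 ∎
  where
  ring : ∀ a x u v → a * v + (0ℚ + x * (u * v)) ≡ (a + x * u) * v
  ring = solve-∀ ℚ-ring

⟦derivFrom-suc⟧ : ∀ k as x → ⟦ derivFrom (k + 1ℚ) as ⟧ x ≡ ⟦ as ⟧ x + ⟦ derivFrom k as ⟧ x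
⟦derivFrom-suc⟧ k [] x = sym (+-identityˡ 0ℚ)
⟦derivFrom-suc⟧ k (a ∷ as) x =
  trans (cong (λ v → (k + 1ℚ) * a + x * v) (⟦derivFrom-suc⟧ (k + 1ℚ) as x))
        (ring k a x (⟦ as ⟧ x) (⟦ derivFrom (k + 1ℚ) as ⟧ x))
  where
  ring : ∀ k a x u d → (k + 1ℚ) * a + x * (u + d) ≡ (a + x * u) + (k * a + x * d)
  ring = solve-∀ ℚ-ring

⟦deriv-∷⟧ : ∀ a as x → ⟦ deriv (a ∷ as) ⟧ x ≡ ⟦ as ⟧ x + x * ⟦ deriv as ⟧ x
⟦deriv-∷⟧ a [] x = sym (trans (+-identityˡ _) (*-zeroʳ x))
⟦deriv-∷⟧ a (b ∷ as) x =
  trans (cong (λ v → 1ℚ * b + x * v) (⟦derivFrom-suc⟧ 1ℚ as x))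
        (ring b x (⟦ as ⟧ x) (⟦ derivFrom 1ℚ as ⟧ x))
  where
  ring : ∀ b x u d → 1ℚ * b + x * (u + d) ≡ (b + x * u) + x * d
  ring = solve-∀ ℚ-ring

⟦deriv-+ᶜ⟧ : ∀ as bs x → ⟦ deriv (as +ᶜ bs) ⟧ x ≡ ⟦ deriv as ⟧ x + ⟦ deriv bs ⟧ x
⟦deriv-+ᶜ⟧ [] bs x = sym (+-identityˡ _)
⟦deriv-+ᶜ⟧ (a ∷ as) [] x = sym (+-identityʳ _)
⟦deriv-+ᶜ⟧ (a ∷ as) (b ∷ bs) x = begin
  ⟦ deriv ((a + b) ∷ (as +ᶜ bs)) ⟧ x
    ≡⟨ ⟦deriv-∷⟧ (a + b) (as +ᶜ bs) x ⟩
  ⟦ as +ᶜ bs ⟧ x + x * ⟦ deriv (as +ᶜ bs) ⟧ x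
    ≡⟨ cong₂ (λ u v → u + x * v) (⟦+ᶜ⟧ as bs x) (⟦deriv-+ᶜ⟧ as bs x) ⟩
  (⟦ as ⟧ x + ⟦ bs ⟧ x) + x * (⟦ deriv as ⟧ x + ⟦ deriv bs ⟧ x)
    ≡⟨ ring x (⟦ as ⟧ x) (⟦ bs ⟧ x) (⟦ deriv as ⟧ x) (⟦ deriv bs ⟧ x) ⟩
  (⟦ as ⟧ x + x * ⟦ deriv as ⟧ x) + (⟦ bs ⟧ x + x * ⟦ deriv bs ⟧ x)
    ≡⟨ sym (cong₂ _+_ (⟦deriv-∷⟧ a as x) (⟦deriv-∷⟧ b bs x)) ⟩
  ⟦ deriv (a ∷ as) ⟧ x + ⟦ deriv (b ∷ bs) ⟧ x ∎
  where
  ring : ∀ x u v du dv → (u + v) + x * (du + dv) ≡ (u + x * du) + (v + x * dv)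
  ring = solve-∀ ℚ-ring

⟦deriv-·ᶜ⟧ : ∀ c as x → ⟦ deriv (c ·ᶜ as) ⟧ x ≡ c * ⟦ deriv as ⟧ x
⟦deriv-·ᶜ⟧ c [] x = sym (*-zeroʳ c)
⟦deriv-·ᶜ⟧ c (a ∷ as) x = begin
  ⟦ deriv (c * a ∷ c ·ᶜ as) ⟧ x                ≡⟨ ⟦deriv-∷⟧ (c * a) (c ·ᶜ as) x ⟩
  ⟦ c ·ᶜ as ⟧ x + x * ⟦ deriv (c ·ᶜ as) ⟧ x     ≡⟨ cong₂ (λ u v → u + x * v) (⟦·ᶜ⟧ c as x) (⟦deriv-·ᶜ⟧ c as x) ⟩
  c * ⟦ as ⟧ x + x * (c * ⟦ deriv as ⟧ x)       ≡⟨ ring c x (⟦ as ⟧ x) (⟦ deriv as ⟧ x) ⟩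
  c * (⟦ as ⟧ x + x * ⟦ deriv as ⟧ x)           ≡⟨ cong (c *_) (sym (⟦deriv-∷⟧ a as x)) ⟩
  c * ⟦ deriv (a ∷ as) ⟧ x                     ∎
  where
  ring : ∀ c x u d → c * u + x * (c * d) ≡ c * (u + x * d)
  ring = solve-∀ ℚ-ring

⟦deriv-*ᶜ⟧ : ∀ as bs x → ⟦ deriv (as *ᶜ bs) ⟧ x ≡ ⟦ deriv as ⟧ x * ⟦ bs ⟧ x + ⟦ as ⟧ x * ⟦ deriv bs ⟧ x
⟦deriv-*ᶜ⟧ [] bs x = sym (trans (cong₂ _+_ (*-zeroˡ (⟦ bs ⟧ x)) (*-zeroˡ (⟦ deriv bs ⟧ x))) (+-identityˡ 0ℚ))
⟦deriv-*ᶜ⟧ (a ∷ as) bs x = begin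
  ⟦ deriv (a ·ᶜ bs +ᶜ (0ℚ ∷ as *ᶜ bs)) ⟧ x
    ≡⟨ ⟦deriv-+ᶜ⟧ (a ·ᶜ bs) (0ℚ ∷ as *ᶜ bs) x ⟩
  ⟦ deriv (a ·ᶜ bs) ⟧ x + ⟦ deriv (0ℚ ∷ as *ᶜ bs) ⟧ x
    ≡⟨ cong₂ _+_ (⟦deriv-·ᶜ⟧ a bs x) (⟦deriv-∷⟧ 0ℚ (as *ᶜ bs) x) ⟩
  a * db + (⟦ as *ᶜ bs ⟧ x + x * ⟦ deriv (as *ᶜ bs) ⟧ x)
    ≡⟨ cong₂ (λ u v → a * db + (u + x * v)) (⟦*ᶜ⟧ as bs x) (⟦deriv-*ᶜ⟧ as bs x) ⟩
  a * db + (⟦ as ⟧ x * b + x * (⟦ deriv as ⟧ x * b + ⟦ as ⟧ x * db))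
    ≡⟨ ring a x (⟦ as ⟧ x) b (⟦ deriv as ⟧ x) db ⟩
  (⟦ as ⟧ x + x * ⟦ deriv as ⟧ x) * b + (a + x * ⟦ as ⟧ x) * db
    ≡⟨ cong (λ u → u * b + (a + x * ⟦ as ⟧ x) * db) (sym (⟦deriv-∷⟧ a as x)) ⟩
  ⟦ deriv (a ∷ as) ⟧ x * b + (a + x * ⟦ as ⟧ x) * db ∎
  where
  b db : ℚ
  b = ⟦ bs ⟧ x
  db = ⟦ deriv bs ⟧ x
  ring : ∀ a x u v du dv → a * dv + (u * v + x * (du * v + u * dv)) ≡ (u + x * du) * v + (a + x * u) * dv
  ring = solve-∀ ℚ-ring

-- A polynomial function on ℚ determines its coefficients

divLinear : ℚ → List ℚ → List ℚ
divLinear c [] = []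
divLinear c (a ∷ []) = []
divLinear c (a ∷ b ∷ as) = ⟦ b ∷ as ⟧ c ∷ divLinear c (b ∷ as)

⟦divLinear⟧ : ∀ c as x → ⟦ as ⟧ x ≡ ⟦ as ⟧ c + (x - c) * ⟦ divLinear c as ⟧ x
⟦divLinear⟧ c [] x = ring x c
  where
  ring : ∀ x c → 0ℚ ≡ 0ℚ + (x - c) * 0ℚ
  ring = solve-∀ ℚ-ring
⟦divLinear⟧ c (a ∷ []) x = ring a x c
  where
  ring : ∀ a x c → a + x * 0ℚ ≡ (a + c * 0ℚ) + (x - c) * 0ℚ
  ring = solve-∀ ℚ-ring
⟦divLinear⟧ c (a ∷ b ∷ as) x =
  trans (cong (λ v → a + x * v) (⟦divLinear⟧ c (b ∷ as) x))
        (ring a x c (⟦ b ∷ as ⟧ c) (⟦ divLinear c (b ∷ as) ⟧ x))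
  where
  ring : ∀ a x c u q → a + x * (u + (x - c) * q) ≡ (a + c * u) + (x - c) * (u + x * q)
  ring = solve-∀ ℚ-ring

length-divLinear : ∀ c a as → length (divLinear c (a ∷ as)) ≡ length as
length-divLinear c a [] = refl
length-divLinear c a (b ∷ as) = cong suc (length-divLinear c b as)

-- The point c = m + 1 is a root, so the quotient by x - c is shorter and vanishes above c.
vanishing-above⇒vanishing : ∀ as m → (∀ x → m < x → ⟦ as ⟧ x ≡ 0ℚ) → ∀ x → ⟦ as ⟧ x ≡ 0ℚ
vanishing-above⇒vanishing as = go (length as) as ℕ.≤-refl
  where
  go : ∀ k as → length as ℕ.≤ k → ∀ m → (∀ x → m < x → ⟦ as ⟧ x ≡ 0ℚ) → ∀ x → ⟦ as ⟧ x ≡ 0ℚ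
  go k [] _ m vanish x = refl
  go (suc k) (a ∷ as) (s≤s len≤k) m vanish x = begin
    ⟦ a ∷ as ⟧ x                       ≡⟨ ⟦divLinear⟧ c (a ∷ as) x ⟩
    ⟦ a ∷ as ⟧ c + (x - c) * ⟦ q ⟧ x    ≡⟨ cong₂ (λ u v → u + (x - c) * v) c-root (q-vanishes x) ⟩
    0ℚ + (x - c) * 0ℚ                  ≡⟨ trans (+-identityˡ ((x - c) * 0ℚ)) (*-zeroʳ (x - c)) ⟩
    0ℚ                                 ∎
    where
    c : ℚ
    c = m + 1ℚ
    q : List ℚ
    q = divLinear c (a ∷ as)
    c-root : ⟦ a ∷ as ⟧ c ≡ 0ℚ
    c-root = vanish c (p<p+1 m)
    q-vanishes-above : ∀ y → c < y → ⟦ q ⟧ y ≡ 0ℚ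
    q-vanishes-above y c<y = p*q≡0⇒p≢0⇒q≡0 (y - c) (⟦ q ⟧ y) (begin
      (y - c) * ⟦ q ⟧ y                 ≡⟨ sym (+-identityˡ _) ⟩
      0ℚ + (y - c) * ⟦ q ⟧ y            ≡⟨ cong (_+ (y - c) * ⟦ q ⟧ y) (sym c-root) ⟩
      ⟦ a ∷ as ⟧ c + (y - c) * ⟦ q ⟧ y   ≡⟨ sym (⟦divLinear⟧ c (a ∷ as) y) ⟩
      ⟦ a ∷ as ⟧ y                      ≡⟨ vanish y (<-trans (p<p+1 m) c<y) ⟩
      0ℚ                                ∎)
      (λ y-c≡0 → <⇒≢ c<y (sym (p-q≡0⇒p≡q y c y-c≡0)))
    q-vanishes : ∀ y → ⟦ q ⟧ y ≡ 0ℚ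
    q-vanishes = go k q (subst (ℕ._≤ k) (sym (length-divLinear c a as)) len≤k) c q-vanishes-above

AllZero : List ℚ → Set
AllZero = All (_≡ 0ℚ)

allZero⇒vanishing : ∀ as → AllZero as → ∀ x → ⟦ as ⟧ x ≡ 0ℚ
allZero⇒vanishing [] [] x = refl
allZero⇒vanishing (a ∷ as) (refl ∷ zs) x =
  trans (cong (λ v → 0ℚ + x * v) (allZero⇒vanishing as zs x)) (trans (+-identityˡ _) (*-zeroʳ x))

vanishing⇒allZero : ∀ as → (∀ x → ⟦ as ⟧ x ≡ 0ℚ) → AllZero as
vanishing⇒allZero [] vanish = []
vanishing⇒allZero (a ∷ as) vanish = a≡0 ∷ vanishing⇒allZero as as-vanishes
  where
  a≡0 : a ≡ 0ℚ
  a≡0 = trans (sym (trans (cong (a +_) (*-zeroˡ (⟦ as ⟧ 0ℚ))) (+-identityʳ a))) (vanish 0ℚ)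
  x*as≡0 : ∀ x → x * ⟦ as ⟧ x ≡ 0ℚ
  x*as≡0 x = trans (sym (trans (cong (_+ x * ⟦ as ⟧ x) a≡0) (+-identityˡ _))) (vanish x)
  as-vanishes : ∀ x → ⟦ as ⟧ x ≡ 0ℚ
  as-vanishes = vanishing-above⇒vanishing as 0ℚ
    (λ x 0<x → p*q≡0⇒p≢0⇒q≡0 x (⟦ as ⟧ x) (x*as≡0 x) (λ x≡0 → <⇒≢ 0<x (sym x≡0)))

derivFrom-allZero : ∀ k as → AllZero as → AllZero (derivFrom k as)
derivFrom-allZero k [] [] = []
derivFrom-allZero k (a ∷ as) (refl ∷ zs) = *-zeroʳ k ∷ derivFrom-allZero (k + 1ℚ) as zs

derivFrom-allZero⁻ : ∀ k as → 0ℚ < k → AllZero (derivFrom k as) → AllZero as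
derivFrom-allZero⁻ k [] 0<k [] = []
derivFrom-allZero⁻ k (a ∷ as) 0<k (ka≡0 ∷ zs) =
  p*q≡0⇒p≢0⇒q≡0 k a ka≡0 (λ k≡0 → <⇒≢ 0<k (sym k≡0))
  ∷ derivFrom-allZero⁻ (k + 1ℚ) as (<-trans 0<k (p<p+1 k)) zs

vanishing⇒deriv-vanishing : ∀ as → (∀ x → ⟦ as ⟧ x ≡ 0ℚ) → ∀ x → ⟦ deriv as ⟧ x ≡ 0ℚ
vanishing⇒deriv-vanishing [] vanish x = refl
vanishing⇒deriv-vanishing (a ∷ as) vanish =
  allZero⇒vanishing (derivFrom 1ℚ as) (derivFrom-allZero 1ℚ as zs)
  where
  zs : AllZero as
  zs with vanishing⇒allZero (a ∷ as) vanish
  ... | _ ∷ zs = zs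

deriv-vanishing⇒constant : ∀ as → (∀ x → ⟦ deriv as ⟧ x ≡ 0ℚ) → ∀ x → ⟦ as ⟧ x ≡ ⟦ as ⟧ 0ℚ
deriv-vanishing⇒constant [] vanish x = refl
deriv-vanishing⇒constant (a ∷ as) vanish x = begin
  a + x * ⟦ as ⟧ x    ≡⟨ cong (λ v → a + x * v) (allZero⇒vanishing as zs x) ⟩
  a + x * 0ℚ          ≡⟨ cong (a +_) (*-zeroʳ x) ⟩
  a + 0ℚ              ≡⟨ cong (a +_) (sym (*-zeroˡ (⟦ as ⟧ 0ℚ))) ⟩
  a + 0ℚ * ⟦ as ⟧ 0ℚ  ∎
  where
  zs : AllZero as
  zs = derivFrom-allZero⁻ 1ℚ as (positive⁻¹ 1ℚ) (vanishing⇒allZero (derivFrom 1ℚ as) vanish)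

eqᵇ⇒≡ : ∀ (X Y : Subset n) → eqᵇ X Y ≡ true → X ≡ Y
eqᵇ⇒≡ [] [] _ = refl
eqᵇ⇒≡ (true ∷ X) (true ∷ Y) e = cong (true ∷_) (eqᵇ⇒≡ X Y e)
eqᵇ⇒≡ (false ∷ X) (false ∷ Y) e = cong (false ∷_) (eqᵇ⇒≡ X Y e)

eqᵇ-refl : ∀ (X : Subset n) → eqᵇ X X ≡ true
eqᵇ-refl [] = refl
eqᵇ-refl (true ∷ X) = eqᵇ-refl X
eqᵇ-refl (false ∷ X) = eqᵇ-refl X

≡⇒eqᵇ : ∀ {X Y : Subset n} → X ≡ Y → eqᵇ X Y ≡ true
≡⇒eqᵇ {X = X} refl = eqᵇ-refl X

eqᵇ≡false⇒≢ : ∀ {X Y : Subset n} → eqᵇ X Y ≡ false → X ≢ Y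
eqᵇ≡false⇒≢ e X≡Y with trans (sym e) (≡⇒eqᵇ X≡Y)
... | ()

≢⇒eqᵇ≡false : ∀ (X Y : Subset n) → X ≢ Y → eqᵇ X Y ≡ false
≢⇒eqᵇ≡false X Y X≢Y with eqᵇ X Y in e
... | true = contradiction (eqᵇ⇒≡ X Y e) X≢Y
... | false = refl

eqᵇ-sym : ∀ (X Y : Subset n) → eqᵇ X Y ≡ eqᵇ Y X
eqᵇ-sym [] [] = refl
eqᵇ-sym (true ∷ X) (true ∷ Y) = eqᵇ-sym X Y
eqᵇ-sym (false ∷ X) (false ∷ Y) = eqᵇ-sym X Y
eqᵇ-sym (true ∷ X) (false ∷ Y) = refl
eqᵇ-sym (false ∷ X) (true ∷ Y) = refl

⊆ᵇ⇒⊆ : ∀ (X Y : Subset n) → ⊆ᵇ X Y ≡ true → X ⊆ Y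
⊆ᵇ⇒⊆ (true ∷ X) (true ∷ Y) e here = here
⊆ᵇ⇒⊆ (true ∷ X) (true ∷ Y) e (there x∈X) = there (⊆ᵇ⇒⊆ X Y e x∈X)
⊆ᵇ⇒⊆ (false ∷ X) (y ∷ Y) e (there x∈X) = there (⊆ᵇ⇒⊆ X Y e x∈X)

⊆⇒⊆ᵇ : ∀ (X Y : Subset n) → X ⊆ Y → ⊆ᵇ X Y ≡ true
⊆⇒⊆ᵇ [] [] X⊆Y = refl
⊆⇒⊆ᵇ (true ∷ X) (true ∷ Y) X⊆Y = ⊆⇒⊆ᵇ X Y (drop-∷-⊆ X⊆Y)
⊆⇒⊆ᵇ (true ∷ X) (false ∷ Y) X⊆Y with X⊆Y here
... | ()
⊆⇒⊆ᵇ (false ∷ X) (y ∷ Y) X⊆Y = ⊆⇒⊆ᵇ X Y (drop-∷-⊆ X⊆Y)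

x∈p─q⁻ : ∀ (p q : Subset n) {x} → x ∈ p ─ q → x ∈ p × x ∉ q
x∈p─q⁻ p q x∈p─q = p─q⊆p p q x∈p─q , λ x∈q → ∉─ p q x∈q x∈p─q
  where
  ∉─ : ∀ {m} (p q : Subset m) {x} → x ∈ q → x ∉ p ─ q
  ∉─ (_ ∷ p) (true ∷ q) here ()
  ∉─ (_ ∷ p) (_ ∷ q) (there x∈q) (there x∈p─q) = ∉─ p q x∈q x∈p─q

∈⇒≢⊥ : ∀ {X : Subset n} {x} → x ∈ X → X ≢ ⊥
∈⇒≢⊥ x∈X refl = ∉⊥ x∈X

⊂⇒≢⊥ : ∀ {X Y : Subset n} → X ⊂ Y → Y ≢ ⊥
⊂⇒≢⊥ (_ , _ , x∈Y , _) = ∈⇒≢⊥ x∈Y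

⊂⇒∃∈─ : ∀ {X Y : Subset n} → X ⊂ Y → ∃[ x ] x ∈ Y ─ X
⊂⇒∃∈─ (_ , x , x∈Y , x∉X) = x , x∈p∧x∉q⇒x∈p─q x∈Y x∉X

⊂⇒≢ : ∀ {X Y : Subset n} → X ⊂ Y → X ≢ Y
⊂⇒≢ X⊂Y refl = ⊂-irref refl X⊂Y

⊆∧≢⇒⊂ : ∀ {X Y : Subset n} → X ⊆ Y → X ≢ Y → X ⊂ Y
⊆∧≢⇒⊂ {X = X} {Y = Y} X⊆Y X≢Y with nonempty? (Y ─ X)
... | yes (x , x∈Y─X) = X⊆Y , x , x∈p─q⁻ Y X x∈Y─X
... | no empty = contradiction (⊆-antisym X⊆Y Y⊆X) X≢Y
  where
  Y⊆X : Y ⊆ X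
  Y⊆X {x} x∈Y with x ∈? X
  ... | yes x∈X = x∈X
  ... | no x∉X = contradiction (x , x∈p∧x∉q⇒x∈p─q x∈Y x∉X) empty

⊊ᵇ⇒⊂ : ∀ (X Y : Subset n) → ⊊ᵇ X Y ≡ true → X ⊂ Y
⊊ᵇ⇒⊂ X Y e = ⊆∧≢⇒⊂ (⊆ᵇ⇒⊆ X Y (∧-conicalˡ _ _ e))
  (eqᵇ≡false⇒≢ (Bool.not-injective (∧-conicalʳ (⊆ᵇ X Y) _ e)))

⊂⇒⊊ᵇ : ∀ (X Y : Subset n) → X ⊂ Y → ⊊ᵇ X Y ≡ true
⊂⇒⊊ᵇ X Y X⊂Y = cong₂ _∧_ (⊆⇒⊆ᵇ X Y (p⊂q⇒p⊆q X⊂Y)) (cong not (≢⇒eqᵇ≡false X Y (⊂⇒≢ X⊂Y)))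

⊄⇒⊊ᵇ≡false : ∀ (X Y : Subset n) → ¬ X ⊂ Y → ⊊ᵇ X Y ≡ false
⊄⇒⊊ᵇ≡false X Y X⊄Y with ⊊ᵇ X Y in e
... | true = contradiction (⊊ᵇ⇒⊂ X Y e) X⊄Y
... | false = refl

─-monoˡ-⊂ : ∀ {F G H : Subset n} → F ⊆ G → G ⊂ H → G ─ F ⊂ H ─ F
─-monoˡ-⊂ {F = F} {G} {H} F⊆G (G⊆H , x , x∈H , x∉G) =
  (λ y∈ → let (y∈G , y∉F) = x∈p─q⁻ G F y∈ in x∈p∧x∉q⇒x∈p─q (G⊆H y∈G) y∉F) ,
  x , x∈p∧x∉q⇒x∈p─q x∈H (x∉G ∘ F⊆G) , x∉G ∘ proj₁ ∘ x∈p─q⁻ G F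

Disjoint : Subset n → Subset n → Set
Disjoint X Y = ∀ {x} → x ∈ X → x ∉ Y

p─q∪q≡p : ∀ {p q : Subset n} → q ⊆ p → (p ─ q) ∪ q ≡ p
p─q∪q≡p {p = p} {q = q} q⊆p = ⊆-antisym ⊆p p⊆
  where
  ⊆p : (p ─ q) ∪ q ⊆ p
  ⊆p x∈ with x∈p∪q⁻ (p ─ q) q x∈
  ... | inj₁ x∈p─q = p─q⊆p p q x∈p─q
  ... | inj₂ x∈q = q⊆p x∈q
  p⊆ : p ⊆ (p ─ q) ∪ q
  p⊆ {x} x∈p with x ∈? q
  ... | yes x∈q = x∈p∪q⁺ (inj₂ x∈q)
  ... | no x∉q = x∈p∪q⁺ (inj₁ (x∈p∧x∉q⇒x∈p─q x∈p x∉q))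

p∪q─q≡p : ∀ {p q : Subset n} → Disjoint p q → (p ∪ q) ─ q ≡ p
p∪q─q≡p {p = p} {q = q} p∩q≡∅ = ⊆-antisym ⊆p p⊆
  where
  ⊆p : (p ∪ q) ─ q ⊆ p
  ⊆p x∈ with x∈p─q⁻ (p ∪ q) q x∈
  ... | x∈p∪q , x∉q with x∈p∪q⁻ p q x∈p∪q
  ...   | inj₁ x∈p = x∈p
  ...   | inj₂ x∈q = contradiction x∈q x∉q
  p⊆ : p ⊆ (p ∪ q) ─ q
  p⊆ x∈p = x∈p∧x∉q⇒x∈p─q (p⊆p∪q q x∈p) (p∩q≡∅ x∈p)

r─p─[q─p]≡r─q : ∀ {p q : Subset n} (r : Subset n) → p ⊆ q → (r ─ p) ─ (q ─ p) ≡ r ─ q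
r─p─[q─p]≡r─q {p = p} {q = q} r p⊆q = ⊆-antisym ⊆r─q r─q⊆
  where
  ⊆r─q : (r ─ p) ─ (q ─ p) ⊆ r ─ q
  ⊆r─q {x} x∈ with x∈p─q⁻ (r ─ p) (q ─ p) x∈
  ... | x∈r─p , x∉q─p with x∈p─q⁻ r p x∈r─p
  ...   | x∈r , x∉p = x∈p∧x∉q⇒x∈p─q x∈r (λ x∈q → x∉q─p (x∈p∧x∉q⇒x∈p─q x∈q x∉p))
  r─q⊆ : r ─ q ⊆ (r ─ p) ─ (q ─ p)
  r─q⊆ x∈ with x∈p─q⁻ r q x∈
  ... | x∈r , x∉q = x∈p∧x∉q⇒x∈p─q (x∈p∧x∉q⇒x∈p─q x∈r (x∉q ∘ p⊆q)) (x∉q ∘ proj₁ ∘ x∈p─q⁻ q p)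

r∪[q─p]∪p≡r∪q : ∀ {p q : Subset n} (r : Subset n) → p ⊆ q → (r ∪ (q ─ p)) ∪ p ≡ r ∪ q
r∪[q─p]∪p≡r∪q {p = p} {q = q} r p⊆q = begin
  (r ∪ (q ─ p)) ∪ p  ≡⟨ ∪-assoc r (q ─ p) p ⟩
  r ∪ ((q ─ p) ∪ p)  ≡⟨ cong (r ∪_) (p─q∪q≡p p⊆q) ⟩
  r ∪ q              ∎

∈-allSubsets : ∀ (X : Subset n) → X ∈ˡ allSubsets n
∈-allSubsets [] = here refl
∈-allSubsets {suc n} (true ∷ X) = ∈-++⁺ˡ (∈-map⁺ (true ∷_) (∈-allSubsets X))
∈-allSubsets {suc n} (false ∷ X) =
  ∈-++⁺ʳ (map (true ∷_) (allSubsets n)) (∈-map⁺ (false ∷_) (∈-allSubsets X))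

∈-filterᵇ⁺ : ∀ {A : Set} (P : A → Bool) {x xs} → x ∈ˡ xs → P x ≡ true → x ∈ˡ filterᵇ P xs
∈-filterᵇ⁺ P x∈xs Px = ∈-filter⁺ (T? ∘ P) x∈xs (Equivalence.from T-≡ Px)

∈-filterᵇ⁻ : ∀ {A : Set} (P : A → Bool) {x} xs → x ∈ˡ filterᵇ P xs → P x ≡ true
∈-filterᵇ⁻ P xs x∈ = Equivalence.to T-≡ (proj₂ (∈-filter⁻ (T? ∘ P) {xs = xs} x∈))

filterᵇ-cong : ∀ {A : Set} {P Q : A → Bool} → (∀ x → P x ≡ Q x) → ∀ xs → filterᵇ P xs ≡ filterᵇ Q xs
filterᵇ-cong {P = P} {Q} P≗Q = filter-≐ (T? ∘ P) (T? ∘ Q) (subst T (P≗Q _) , subst T (sym (P≗Q _)))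

∈-Plist⁺ : ∀ (M : RawMat n) {X} → InP M X → X ∈ˡ Plist M
∈-Plist⁺ M {X} X∈P = ∈-filterᵇ⁺ (inPᵇ M) (∈-allSubsets X) X∈P

∈-Plist⁻ : ∀ (M : RawMat n) {X} → X ∈ˡ Plist M → InP M X
∈-Plist⁻ {n} M = ∈-filterᵇ⁻ (inPᵇ M) (allSubsets n)

-- Polynomials restricted to coordinate lines

_[_≔_] : Vect n → Subset n → ℚ → Vect n
(s [ G ≔ x ]) X = if eqᵇ G X then x else s X

[≔]-self : ∀ (s : Vect n) G X → (s [ G ≔ s G ]) X ≡ s X
[≔]-self s G X with eqᵇ G X in G=X
... | true = cong s (eqᵇ⇒≡ G X G=X)
... | false = refl

eval-cong : ∀ {s s' : Vect n} → (∀ X → s X ≡ s' X) → ∀ p → eval s p ≡ eval s' p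
eval-cong s≗s' (con c) = refl
eval-cong s≗s' (var X) = s≗s' X
eval-cong s≗s' (p ⊕ q) = cong₂ _+_ (eval-cong s≗s' p) (eval-cong s≗s' q)
eval-cong s≗s' (p ⊗ q) = cong₂ _*_ (eval-cong s≗s' p) (eval-cong s≗s' q)

alongLine : Vect n → Subset n → Poly n → List ℚ
alongLine s G (con c) = c ∷ []
alongLine s G (var X) = if eqᵇ G X then 0ℚ ∷ 1ℚ ∷ [] else s X ∷ []
alongLine s G (p ⊕ q) = alongLine s G p +ᶜ alongLine s G q
alongLine s G (p ⊗ q) = alongLine s G p *ᶜ alongLine s G q

⟦alongLine⟧ : ∀ (s : Vect n) G p x → ⟦ alongLine s G p ⟧ x ≡ eval (s [ G ≔ x ]) p
⟦alongLine⟧ s G (con c) x = trans (cong (c +_) (*-zeroʳ x)) (+-identityʳ c)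
⟦alongLine⟧ s G (var X) x with eqᵇ G X
... | true = ring x
  where
  ring : ∀ x → 0ℚ + x * (1ℚ + x * 0ℚ) ≡ x
  ring = solve-∀ ℚ-ring
... | false = trans (cong (s X +_) (*-zeroʳ x)) (+-identityʳ (s X))
⟦alongLine⟧ s G (p ⊕ q) x =
  trans (⟦+ᶜ⟧ (alongLine s G p) (alongLine s G q) x) (cong₂ _+_ (⟦alongLine⟧ s G p x) (⟦alongLine⟧ s G q x))
⟦alongLine⟧ s G (p ⊗ q) x =
  trans (⟦*ᶜ⟧ (alongLine s G p) (alongLine s G q) x) (cong₂ _*_ (⟦alongLine⟧ s G p x) (⟦alongLine⟧ s G q x))

⟦deriv-alongLine⟧ : ∀ (s : Vect n) G p x → ⟦ deriv (alongLine s G p) ⟧ x ≡ eval (s [ G ≔ x ]) (∂ G p)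
⟦deriv-alongLine⟧ s G (con c) x = refl
⟦deriv-alongLine⟧ s G (var X) x with eqᵇ G X
... | true = trans (cong (_+ x * 0ℚ) (*-identityˡ 1ℚ)) (trans (cong (1ℚ +_) (*-zeroʳ x)) (+-identityʳ 1ℚ))
... | false = refl
⟦deriv-alongLine⟧ s G (p ⊕ q) x =
  trans (⟦deriv-+ᶜ⟧ (alongLine s G p) (alongLine s G q) x)
        (cong₂ _+_ (⟦deriv-alongLine⟧ s G p x) (⟦deriv-alongLine⟧ s G q x))
⟦deriv-alongLine⟧ s G (p ⊗ q) x =
  trans (⟦deriv-*ᶜ⟧ (alongLine s G p) (alongLine s G q) x)
        (cong₂ _+_ (cong₂ _*_ (⟦deriv-alongLine⟧ s G p x) (⟦alongLine⟧ s G q x))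
                   (cong₂ _*_ (⟦alongLine⟧ s G p x) (⟦deriv-alongLine⟧ s G q x)))

vanishing-on-line⇒∂-vanishing : ∀ (s : Vect n) G p →
  (∀ x → eval (s [ G ≔ x ]) p ≡ 0ℚ) → eval s (∂ G p) ≡ 0ℚ
vanishing-on-line⇒∂-vanishing s G p vanish = begin
  eval s (∂ G p)                     ≡⟨ eval-cong ([≔]-self s G) (∂ G p) ⟨
  eval (s [ G ≔ s G ]) (∂ G p)       ≡⟨ ⟦deriv-alongLine⟧ s G p (s G) ⟨
  ⟦ deriv (alongLine s G p) ⟧ (s G)  ≡⟨ vanishing⇒deriv-vanishing (alongLine s G p)
                                          (λ x → trans (⟦alongLine⟧ s G p x) (vanish x)) (s G) ⟩
  0ℚ                                 ∎

∂-vanishing-on-line⇒constant : ∀ (s : Vect n) G p →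
  (∀ x → eval (s [ G ≔ x ]) (∂ G p) ≡ 0ℚ) → eval s p ≡ eval (s [ G ≔ 0ℚ ]) p
∂-vanishing-on-line⇒constant s G p vanish = begin
  eval s p                      ≡⟨ eval-cong ([≔]-self s G) p ⟨
  eval (s [ G ≔ s G ]) p        ≡⟨ ⟦alongLine⟧ s G p (s G) ⟨
  ⟦ alongLine s G p ⟧ (s G)     ≡⟨ deriv-vanishing⇒constant (alongLine s G p)
                                     (λ x → trans (⟦deriv-alongLine⟧ s G p x) (vanish x)) (s G) ⟩
  ⟦ alongLine s G p ⟧ 0ℚ        ≡⟨ ⟦alongLine⟧ s G p 0ℚ ⟩
  eval (s [ G ≔ 0ℚ ]) p         ∎

infixl 6 _⊖_

_⊖_ : Poly n → Poly n → Poly n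
p ⊖ q = p ⊕ (con (- 1ℚ) ⊗ q)

eval-⊖ : ∀ (s : Vect n) p q → eval s (p ⊖ q) ≡ eval s p - eval s q
eval-⊖ s p q = ring (eval s p) (eval s q)
  where
  ring : ∀ a b → a + (- 1ℚ) * b ≡ a - b
  ring = solve-∀ ℚ-ring

eval-∂-⊖ : ∀ (s : Vect n) G p q → eval s (∂ G (p ⊖ q)) ≡ eval s (∂ G p) - eval s (∂ G q)
eval-∂-⊖ s G p q = ring (eval s (∂ G p)) (eval s q) (eval s (∂ G q))
  where
  ring : ∀ a b c → a + (0ℚ * b + (- 1ℚ) * c) ≡ a - c
  ring = solve-∀ ℚ-ring

∂-cong-on-line : ∀ (s : Vect n) G p q →
  (∀ x → eval (s [ G ≔ x ]) p ≡ eval (s [ G ≔ x ]) q) → eval s (∂ G p) ≡ eval s (∂ G q)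
∂-cong-on-line s G p q p≡q = p-q≡0⇒p≡q _ _ (trans (sym (eval-∂-⊖ s G p q))
  (vanishing-on-line⇒∂-vanishing s G (p ⊖ q)
    (λ x → trans (eval-⊖ (s [ G ≔ x ]) p q) (p≡q⇒p-q≡0 (p≡q x)))))

∂-comm : ∀ (s : Vect n) A B p → eval s (∂ A (∂ B p)) ≡ eval s (∂ B (∂ A p))
∂-comm s A B (con c) = refl
∂-comm s A B (var X) with eqᵇ A X | eqᵇ B X
... | true | true = refl
... | true | false = refl
... | false | true = refl
... | false | false = refl
∂-comm s A B (p ⊕ q) = cong₂ _+_ (∂-comm s A B p) (∂-comm s A B q)
∂-comm s A B (p ⊗ q) =
  trans (cong₂ (λ u v → (u * q′ + ∂Bp * ∂Aq) + (∂Ap * ∂Bq + p′ * v)) (∂-comm s A B p) (∂-comm s A B q))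
        (ring (eval s (∂ B (∂ A p))) q′ ∂Bp ∂Aq ∂Ap ∂Bq p′ (eval s (∂ B (∂ A q))))
  where
  p′ q′ ∂Ap ∂Bp ∂Aq ∂Bq : ℚ
  p′ = eval s p
  q′ = eval s q
  ∂Ap = eval s (∂ A p)
  ∂Bp = eval s (∂ B p)
  ∂Aq = eval s (∂ A q)
  ∂Bq = eval s (∂ B q)
  ring : ∀ a b c d e f g h → (a * b + c * d) + (e * f + g * h) ≡ (a * b + e * f) + (c * d + g * h)
  ring = solve-∀ ℚ-ring

infix 4 _≈[_]_

_≈[_]_ : Poly n → RawMat n → Poly n → Set
p ≈[ M ] q = ∀ t → evalOn M p t ≡ evalOn M q t

restrictV-[≔] : ∀ (M : RawMat n) {G} → InP M G → ∀ t x X →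
  restrictV M (t [ G ≔ x ]) X ≡ (restrictV M t [ G ≔ x ]) X
restrictV-[≔] M {G} G∈P t x X with eqᵇ G X in G=X
... | true = cong (λ b → if b then x else 0ℚ) (subst (InP M) (eqᵇ⇒≡ G X G=X) G∈P)
... | false = refl

∂-cong : ∀ (M : RawMat n) {G} → InP M G → ∀ p q → p ≈[ M ] q → ∂ G p ≈[ M ] ∂ G q
∂-cong M {G} G∈P p q p≈q t = ∂-cong-on-line (restrictV M t) G p q λ x →
  trans (sym (eval-cong (restrictV-[≔] M G∈P t x) p))
        (trans (p≈q (t [ G ≔ x ])) (eval-cong (restrictV-[≔] M G∈P t x) q))

foldr-∂-cong : ∀ (M : RawMat n) {Gs} → All (InP M) Gs → ∀ p q → p ≈[ M ] q → foldr ∂ p Gs ≈[ M ] foldr ∂ q Gs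
foldr-∂-cong M [] p q p≈q = p≈q
foldr-∂-cong M {_ ∷ Gs} (G∈P ∷ Gs⊆P) p q p≈q =
  ∂-cong M G∈P (foldr ∂ p Gs) (foldr ∂ q Gs) (foldr-∂-cong M Gs⊆P p q p≈q)

∂-foldr-comm : ∀ (M : RawMat n) A {Gs} → All (InP M) Gs → ∀ p → ∂ A (foldr ∂ p Gs) ≈[ M ] foldr ∂ (∂ A p) Gs
∂-foldr-comm M A [] p t = refl
∂-foldr-comm M A {B ∷ Gs} (B∈P ∷ Gs⊆P) p t =
  trans (∂-comm (restrictV M t) A B (foldr ∂ p Gs)) (∂-cong M B∈P (∂ A (foldr ∂ p Gs)) (foldr ∂ (∂ A p) Gs) (∂-foldr-comm M A Gs⊆P p) t)

-- Moving one 𝒫(M)-coordinate at a time to 0.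
∂-vanishing⇒constant : ∀ (M : RawMat n) p → (∀ G → InP M G → ∀ t → evalOn M (∂ G p) t ≡ 0ℚ) →
  ∀ t → evalOn M p t ≡ evalOn M p zeroV
∂-vanishing⇒constant {n} M p ∂p≡0 t =
  trans (go (Plist M) (λ _ → ∈-Plist⁻ M) (restrictV M t) off𝒫 offList)
        (eval-cong (λ X → sym (restrictV-zero X)) p)
  where
  SupportedOn𝒫 : Vect n → Set
  SupportedOn𝒫 s = ∀ X → inPᵇ M X ≡ false → s X ≡ 0ℚ
  restrictV-zero : ∀ X → restrictV M zeroV X ≡ 0ℚ
  restrictV-zero X with inPᵇ M X
  ... | true = refl
  ... | false = refl
  off𝒫 : SupportedOn𝒫 (restrictV M t)
  off𝒫 X X∉P = cong (λ b → if b then t X else 0ℚ) X∉P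
  offList : ∀ X → X ∉ˡ Plist M → restrictV M t X ≡ 0ℚ
  offList X X∉L with inPᵇ M X in X∈P
  ... | true = contradiction (∈-Plist⁺ M X∈P) X∉L
  ... | false = refl
  ∂p≡0-on : ∀ G → InP M G → ∀ s → SupportedOn𝒫 s → eval s (∂ G p) ≡ 0ℚ
  ∂p≡0-on G G∈P s supp = trans (eval-cong s≗ (∂ G p)) (∂p≡0 G G∈P s)
    where
    s≗ : ∀ X → s X ≡ restrictV M s X
    s≗ X with inPᵇ M X in X∈P
    ... | true = refl
    ... | false = supp X X∈P
  go : ∀ L → (∀ G → G ∈ˡ L → InP M G) → ∀ s → SupportedOn𝒫 s → (∀ X → X ∉ˡ L → s X ≡ 0ℚ) →
       eval s p ≡ eval (λ _ → 0ℚ) p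
  go [] _ s _ offL = eval-cong (λ X → offL X (λ ())) p
  go (G ∷ L) L⊆P s supp offL =
    trans (∂-vanishing-on-line⇒constant s G p (λ x → ∂p≡0-on G G∈P (s [ G ≔ x ]) (supp[≔] x)))
          (go L (λ H H∈L → L⊆P H (there H∈L)) (s [ G ≔ 0ℚ ]) (supp[≔] 0ℚ) offL[≔])
    where
    G∈P : InP M G
    G∈P = L⊆P G (here refl)
    supp[≔] : ∀ x → SupportedOn𝒫 (s [ G ≔ x ])
    supp[≔] x X X∉P with eqᵇ G X in G=X
    ... | true = contradiction (trans (sym X∉P) (subst (InP M) (eqᵇ⇒≡ G X G=X) G∈P)) λ ()
    ... | false = supp X X∉P
    offL[≔] : ∀ X → X ∉ˡ L → (s [ G ≔ 0ℚ ]) X ≡ 0ℚ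
    offL[≔] X X∉L with eqᵇ G X in G=X
    ... | true = refl
    ... | false = offL X λ { (here X≡G) → eqᵇ≡false⇒≢ G=X (sym X≡G) ; (there X∈L) → X∉L X∈L }

∑ : ∀ {A : Set} → List A → (A → ℚ) → ℚ
∑ [] f = 0ℚ
∑ (x ∷ xs) f = f x + ∑ xs f

module _ {A : Set} where

  ∑-cong : ∀ (xs : List A) {f g} → (∀ x → x ∈ˡ xs → f x ≡ g x) → ∑ xs f ≡ ∑ xs g
  ∑-cong [] f≗g = refl
  ∑-cong (x ∷ xs) f≗g = cong₂ _+_ (f≗g x (here refl)) (∑-cong xs (λ y y∈xs → f≗g y (there y∈xs)))

  ∑-zero : ∀ (xs : List A) {f} → (∀ x → x ∈ˡ xs → f x ≡ 0ℚ) → ∑ xs f ≡ 0ℚ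
  ∑-zero [] f≗0 = refl
  ∑-zero (x ∷ xs) f≗0 =
    trans (cong₂ _+_ (f≗0 x (here refl)) (∑-zero xs (λ y y∈xs → f≗0 y (there y∈xs)))) (+-identityˡ 0ℚ)

  ∑-++ : ∀ (xs ys : List A) f → ∑ (xs ++ ys) f ≡ ∑ xs f + ∑ ys f
  ∑-++ [] ys f = sym (+-identityˡ _)
  ∑-++ (x ∷ xs) ys f = trans (cong (f x +_) (∑-++ xs ys f)) (sym (+-assoc (f x) (∑ xs f) (∑ ys f)))

  ∑-filterᵇ : ∀ (P : A → Bool) xs f → ∑ (filterᵇ P xs) f ≡ ∑ xs (λ x → if P x then f x else 0ℚ)
  ∑-filterᵇ P [] f = refl
  ∑-filterᵇ P (x ∷ xs) f with P x
  ... | true = cong (f x +_) (∑-filterᵇ P xs f)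
  ... | false = trans (∑-filterᵇ P xs f) (sym (+-identityˡ _))

  ∑-+ : ∀ (xs : List A) f g → ∑ xs (λ x → f x + g x) ≡ ∑ xs f + ∑ xs g
  ∑-+ [] f g = sym (+-identityˡ 0ℚ)
  ∑-+ (x ∷ xs) f g = trans (cong ((f x + g x) +_) (∑-+ xs f g)) (ring (f x) (g x) (∑ xs f) (∑ xs g))
    where
    ring : ∀ a b c d → (a + b) + (c + d) ≡ (a + c) + (b + d)
    ring = solve-∀ ℚ-ring

  ∑-- : ∀ (xs : List A) f g → ∑ xs (λ x → f x - g x) ≡ ∑ xs f - ∑ xs g
  ∑-- [] f g = refl
  ∑-- (x ∷ xs) f g = trans (cong (f x - g x +_) (∑-- xs f g)) (ring (f x) (g x) (∑ xs f) (∑ xs g))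
    where
    ring : ∀ a b c d → (a - b) + (c - d) ≡ (a + c) - (b + d)
    ring = solve-∀ ℚ-ring

  ∑-*ʳ : ∀ (xs : List A) f c → ∑ xs f * c ≡ ∑ xs (λ x → f x * c)
  ∑-*ʳ [] f c = *-zeroˡ c
  ∑-*ʳ (x ∷ xs) f c = trans (*-distribʳ-+ c (f x) (∑ xs f)) (cong (f x * c +_) (∑-*ʳ xs f c))

  ∑-*ˡ : ∀ (xs : List A) f c → c * ∑ xs f ≡ ∑ xs (λ x → c * f x)
  ∑-*ˡ [] f c = *-zeroʳ c
  ∑-*ˡ (x ∷ xs) f c = trans (*-distribˡ-+ c (f x) (∑ xs f)) (cong (c * f x +_) (∑-*ˡ xs f c))

∑-map : ∀ {A B : Set} (g : A → B) xs f → ∑ (map g xs) f ≡ ∑ xs (f ∘ g)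
∑-map g [] f = refl
∑-map g (x ∷ xs) f = cong (f (g x) +_) (∑-map g xs f)

∑-comm : ∀ {A B : Set} (xs : List A) (ys : List B) (h : A → B → ℚ) →
  ∑ xs (λ x → ∑ ys (h x)) ≡ ∑ ys (λ y → ∑ xs (λ x → h x y))
∑-comm [] ys h = sym (∑-zero ys {λ _ → 0ℚ} (λ _ _ → refl))
∑-comm (x ∷ xs) ys h =
  trans (cong (∑ ys (h x) +_) (∑-comm xs ys h)) (sym (∑-+ ys (h x) (λ y → ∑ xs (λ x′ → h x′ y))))

lincomb≡∑ : ∀ (L : List (Subset n)) t f X → lincomb L t f X ≡ ∑ L (λ G → t G * f G X)
lincomb≡∑ [] t f X = refl
lincomb≡∑ (G ∷ L) t f X = cong (t G * f G X +_) (lincomb≡∑ L t f X)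

𝟙 : Bool → ℚ
𝟙 b = if b then 1ℚ else 0ℚ

∑-allSubsets-δ : ∀ (H : Subset n) c → ∑ (allSubsets n) (λ G → if eqᵇ H G then c else 0ℚ) ≡ c
∑-allSubsets-δ [] c = +-identityʳ c
∑-allSubsets-δ {suc n} (b ∷ H) c = begin
  ∑ (map (true ∷_) (allSubsets n) ++ map (false ∷_) (allSubsets n)) δc
    ≡⟨ ∑-++ (map (true ∷_) (allSubsets n)) (map (false ∷_) (allSubsets n)) δc ⟩
  ∑ (map (true ∷_) (allSubsets n)) δc + ∑ (map (false ∷_) (allSubsets n)) δc
    ≡⟨ cong₂ _+_ (∑-map (true ∷_) (allSubsets n) δc) (∑-map (false ∷_) (allSubsets n) δc) ⟩
  ∑ (allSubsets n) (δc ∘ (true ∷_)) + ∑ (allSubsets n) (δc ∘ (false ∷_))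
    ≡⟨ halves b ⟩
  c ∎
  where
  δc : Subset (suc n) → ℚ
  δc G = if eqᵇ (b ∷ H) G then c else 0ℚ
  halves : ∀ b → ∑ (allSubsets n) (λ G → if eqᵇ (b ∷ H) (true ∷ G) then c else 0ℚ)
               + ∑ (allSubsets n) (λ G → if eqᵇ (b ∷ H) (false ∷ G) then c else 0ℚ) ≡ c
  halves true = trans (cong₂ _+_ (∑-allSubsets-δ H c) (∑-zero (allSubsets n) (λ _ _ → refl))) (+-identityʳ c)
  halves false = trans (cong₂ _+_ (∑-zero (allSubsets n) (λ _ _ → refl)) (∑-allSubsets-δ H c)) (+-identityˡ c)

∑-Plist-δ : ∀ (N : RawMat n) {H} (f : Subset n → ℚ) → InP N H → ∑ (Plist N) (λ G → 𝟙 (eqᵇ H G) * f G) ≡ f H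
∑-Plist-δ {n} N {H} f H∈P = begin
  ∑ (Plist N) (λ G → 𝟙 (eqᵇ H G) * f G)
    ≡⟨ ∑-filterᵇ (inPᵇ N) (allSubsets n) _ ⟩
  ∑ (allSubsets n) (λ G → if inPᵇ N G then 𝟙 (eqᵇ H G) * f G else 0ℚ)
    ≡⟨ ∑-cong (allSubsets n) (λ G _ → pointwise G) ⟩
  ∑ (allSubsets n) (λ G → if eqᵇ H G then f H else 0ℚ)
    ≡⟨ ∑-allSubsets-δ H (f H) ⟩
  f H ∎
  where
  pointwise : ∀ G → (if inPᵇ N G then 𝟙 (eqᵇ H G) * f G else 0ℚ) ≡ (if eqᵇ H G then f H else 0ℚ)
  pointwise G with eqᵇ H G in H=G
  ... | true rewrite eqᵇ⇒≡ H G H=G | H∈P = *-identityˡ (f G)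
  ... | false with inPᵇ N G
  ...   | true = *-zeroˡ (f G)
  ...   | false = refl

-- Minors of matroids

restr-flat⁻ : ∀ (M : RawMat n) {F X} → IsFlat (restr M F) X → IsFlat M X × X ⊆ F
restr-flat⁻ M {F} {X} X-flat = ∧-conicalˡ _ _ X-flat , ⊆ᵇ⇒⊆ X F (∧-conicalʳ (flat M X) _ X-flat)

restr-flat⁺ : ∀ (M : RawMat n) {F X} → IsFlat M X → X ⊆ F → IsFlat (restr M F) X
restr-flat⁺ M {F} {X} X-flat X⊆F = cong₂ _∧_ X-flat (⊆⇒⊆ᵇ X F X⊆F)

contr-flat⁻ : ∀ (M : RawMat n) {F X} → IsFlat (contr M F) X → IsFlat M (X ∪ F) × X ⊆ ground M ─ F
contr-flat⁻ M {F} {X} X-flat =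
  ∧-conicalˡ _ _ X-flat , ⊆ᵇ⇒⊆ X (ground M ─ F) (∧-conicalʳ (flat M (X ∪ F)) _ X-flat)

contr-flat⁺ : ∀ (M : RawMat n) {F X} → IsFlat M (X ∪ F) → X ⊆ ground M ─ F → IsFlat (contr M F) X
contr-flat⁺ M {F} {X} XF-flat X⊆E─F = cong₂ _∧_ XF-flat (⊆⇒⊆ᵇ X (ground M ─ F) X⊆E─F)

contr-flat-disjoint : ∀ (M : RawMat n) {F X} → IsFlat (contr M F) X → Disjoint X F
contr-flat-disjoint M {F} {X} X-flat x∈X = proj₂ (x∈p─q⁻ (ground M) F (proj₂ (contr-flat⁻ M X-flat) x∈X))

⊥-flat⇒loopless : ∀ (N : RawMat n) → IsFlat N ⊥ → Loopless N
⊥-flat⇒loopless {n} N ⊥-flat = foldr-∩-⊥ (ground N) (flats N) (∈-filterᵇ⁺ (flat N) (∈-allSubsets ⊥) ⊥-flat)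
  where
  foldr-∩-⊥ : ∀ (E : Subset n) Xs → ⊥ ∈ˡ Xs → foldr _∩_ E Xs ≡ ⊥
  foldr-∩-⊥ E (X ∷ Xs) (here refl) = ∩-zeroˡ _
  foldr-∩-⊥ E (X ∷ Xs) (there ⊥∈Xs) = trans (cong (X ∩_) (foldr-∩-⊥ E Xs ⊥∈Xs)) (∩-zeroʳ X)

module Matroid (M : RawMat n) (M-matroid : IsMatroid M) where
  open IsMatroid M-matroid

  E : Subset n
  E = ground M

  hat0-flat : IsFlat M (hat0 M)
  hat0-flat = foldr-∩-flat (flats M) (λ X X∈flats → ∈-filterᵇ⁻ (flat M) (allSubsets _) X∈flats)
    where
    foldr-∩-flat : ∀ Xs → (∀ X → X ∈ˡ Xs → IsFlat M X) → IsFlat M (foldr _∩_ E Xs)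
    foldr-∩-flat [] _ = F1
    foldr-∩-flat (X ∷ Xs) Xs-flat =
      F2 X _ (Xs-flat X (here refl)) (foldr-∩-flat Xs (λ Y Y∈Xs → Xs-flat Y (there Y∈Xs)))

  ⊥-flat : Loopless M → IsFlat M ⊥
  ⊥-flat loopless = subst (IsFlat M) loopless hat0-flat

  InP⁺ : Loopless M → ∀ {X} → IsFlat M X → ⊥ ⊂ X → X ⊂ E → InP M X
  InP⁺ loopless {X} X-flat ⊥⊂X X⊂E = cong₂ _∧_ X-flat (cong₂ _∧_
    (cong not (≢⇒eqᵇ≡false X (hat0 M) (λ X≡0 → ⊂⇒≢ ⊥⊂X (sym (trans X≡0 loopless)))))
    (cong not (≢⇒eqᵇ≡false X E (⊂⇒≢ X⊂E))))

  InP⁻ : Loopless M → ∀ {X} → InP M X → IsFlat M X × ⊥ ⊂ X × X ⊂ E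
  InP⁻ loopless {X} X∈P =
    X-flat ,
    ⊆∧≢⇒⊂ ⊥⊆ (λ ⊥≡X → eqᵇ≡false⇒≢ X≢0 (trans (sym ⊥≡X) (sym loopless))) ,
    ⊆∧≢⇒⊂ (flat⊆ground X X-flat) (eqᵇ≡false⇒≢ X≢E)
    where
    X-flat : IsFlat M X
    X-flat = ∧-conicalˡ _ _ X∈P
    X-proper : not (eqᵇ X (hat0 M)) ∧ not (eqᵇ X E) ≡ true
    X-proper = ∧-conicalʳ (flat M X) _ X∈P
    X≢0 : eqᵇ X (hat0 M) ≡ false
    X≢0 = Bool.not-injective (∧-conicalˡ _ _ X-proper)
    X≢E : eqᵇ X E ≡ false
    X≢E = Bool.not-injective (∧-conicalʳ (not (eqᵇ X (hat0 M))) _ X-proper)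

  -- Covers exist by (F3); each step increases the cardinality, which bounds the length.
  coverChain-to-E : ∀ F → IsFlat M F → ∃[ k ] CoverChain M F E k
  coverChain-to-E F F-flat = go n F F-flat (ℕ.m≤m+n n ∣ F ∣)
    where
    go : ∀ k F → IsFlat M F → n ℕ.≤ k ℕ.+ ∣ F ∣ → ∃[ k ] CoverChain M F E k
    go k F F-flat n≤k+∣F∣ with Vec.≡-dec Bool._≟_ F E
    ... | yes refl = 0 , here F
    ... | no F≢E with ⊆∧≢⇒⊂ (flat⊆ground F F-flat) F≢E
    ...   | _ , x , x∈E , x∉F with F3-exists F F-flat x x∈E x∉F
    ...     | G , G-covers@(G-flat , F⊂G , _) , _ with k
    ...       | zero = contradiction (ℕ.<-≤-trans (p⊂q⇒∣p∣<∣q∣ F⊂G) (∣p∣≤n G)) (ℕ.≤⇒≯ n≤k+∣F∣)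
    ...       | suc k with go k G G-flat (ℕ.≤-trans n≤k+∣F∣ (subst (ℕ._≤ k ℕ.+ ∣ G ∣) (ℕ.+-suc k ∣ F ∣)
                                                       (ℕ.+-monoʳ-≤ k (p⊂q⇒∣p∣<∣q∣ F⊂G))))
    ...         | m , chain = suc m , step G-covers chain

  rank-exists : Loopless M → E ≢ ⊥ → ∃[ r ] HasRank M (suc r)
  rank-exists loopless E≢⊥ with coverChain-to-E (hat0 M) hat0-flat
  ... | zero , chain = contradiction (trans (sym (coverChain-zero chain)) loopless) E≢⊥
    where
    coverChain-zero : ∀ {A B} → CoverChain M A B 0 → A ≡ B
    coverChain-zero (here _) = refl
  ... | suc r , chain = r , chain

  module Restriction (F : Subset n) (F-flat : IsFlat M F) where
    R : RawMat n
    R = restr M F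

    covers⁻ : ∀ {K G} → Covers R K G → Covers M K G
    covers⁻ (G-flat , K⊂G , minimal) =
      proj₁ (restr-flat⁻ M G-flat) , K⊂G ,
      λ H H-flat K⊂H H⊆G → minimal H (restr-flat⁺ M H-flat (⊆-trans H⊆G (proj₂ (restr-flat⁻ M G-flat)))) K⊂H H⊆G

    covers⁺ : ∀ {K G} → G ⊆ F → Covers M K G → Covers R K G
    covers⁺ G⊆F (G-flat , K⊂G , minimal) =
      restr-flat⁺ M G-flat G⊆F , K⊂G , λ H H-flat → minimal H (proj₁ (restr-flat⁻ M H-flat))

    -- G ∩ F is a flat strictly between K and G, hence equal to G.
    cover-inside : ∀ {K G x} → IsFlat R K → Covers M K G → x ∈ G → x ∈ F → x ∉ K → G ⊆ F
    cover-inside {K} {G} {x} K-flat (G-flat , K⊂G , minimal) x∈G x∈F x∉K =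
      subst (_⊆ F) G∩F≡G (p∩q⊆q G F)
      where
      K⊆G∩F : K ⊆ G ∩ F
      K⊆G∩F y∈K = x∈p∩q⁺ (p⊂q⇒p⊆q K⊂G y∈K , proj₂ (restr-flat⁻ M K-flat) y∈K)
      G∩F≡G : G ∩ F ≡ G
      G∩F≡G = minimal (G ∩ F) (F2 G F G-flat F-flat) (K⊆G∩F , x , x∈p∩q⁺ (x∈G , x∈F) , x∉K) (p∩q⊆p G F)

    isMatroid : IsMatroid R
    isMatroid = record
      { flat⊆ground = λ X X-flat → proj₂ (restr-flat⁻ M X-flat)
      ; F1 = restr-flat⁺ M F-flat ⊆-refl
      ; F2 = λ X Y X-flat Y-flat →
          restr-flat⁺ M (F2 X Y (proj₁ (restr-flat⁻ M X-flat)) (proj₁ (restr-flat⁻ M Y-flat)))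
                        (⊆-trans (p∩q⊆p X Y) (proj₂ (restr-flat⁻ M X-flat)))
      ; F3-exists = λ K K-flat x x∈F x∉K →
          let (G , G-covers , x∈G) = F3-exists K (proj₁ (restr-flat⁻ M K-flat)) x (flat⊆ground F F-flat x∈F) x∉K
          in G , covers⁺ (cover-inside K-flat G-covers x∈G x∈F x∉K) G-covers , x∈G
      ; F3-unique = λ K K-flat x x∈F x∉K G G′ G-covers G′-covers →
          F3-unique K (proj₁ (restr-flat⁻ M K-flat)) x (flat⊆ground F F-flat x∈F) x∉K G G′
                    (covers⁻ G-covers) (covers⁻ G′-covers)
      }

    loopless : Loopless M → Loopless R
    loopless M-loopless = ⊥-flat⇒loopless R (restr-flat⁺ M (⊥-flat M-loopless) ⊥⊆)

  module Contraction (F : Subset n) (F-flat : IsFlat M F) where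
    C : RawMat n
    C = contr M F

    F⊆E : F ⊆ E
    F⊆E = flat⊆ground F F-flat

    flat-─ : ∀ {H} → IsFlat M H → F ⊆ H → IsFlat C (H ─ F)
    flat-─ {H} H-flat F⊆H = contr-flat⁺ M (subst (IsFlat M) (sym (p─q∪q≡p F⊆H)) H-flat) H─F⊆E─F
      where
      H─F⊆E─F : H ─ F ⊆ E ─ F
      H─F⊆E─F x∈H─F with x∈p─q⁻ H F x∈H─F
      ... | x∈H , x∉F = x∈p∧x∉q⇒x∈p─q (flat⊆ground H H-flat x∈H) x∉F

    ∪F-⊂ : ∀ {K G} → IsFlat C G → K ⊂ G → K ∪ F ⊂ G ∪ F
    ∪F-⊂ {K} {G} G-flat (K⊆G , x , x∈G , x∉K) =
      ∪F-mono K⊆G , x , p⊆p∪q F x∈G , x∉K∪F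
      where
      ∪F-mono : ∀ {X Y} → X ⊆ Y → X ∪ F ⊆ Y ∪ F
      ∪F-mono {X} X⊆Y y∈ with x∈p∪q⁻ X F y∈
      ... | inj₁ y∈X = p⊆p∪q F (X⊆Y y∈X)
      ... | inj₂ y∈F = q⊆p∪q _ F y∈F
      x∉K∪F : x ∉ K ∪ F
      x∉K∪F x∈ with x∈p∪q⁻ K F x∈
      ... | inj₁ x∈K = x∉K x∈K
      ... | inj₂ x∈F = contr-flat-disjoint M G-flat x∈G x∈F

    ─F-⊂ : ∀ {K H} → IsFlat C K → K ∪ F ⊂ H → K ⊂ H ─ F
    ─F-⊂ {K} {H} K-flat (K∪F⊆H , x , x∈H , x∉K∪F) =
      (λ y∈K → x∈p∧x∉q⇒x∈p─q (K∪F⊆H (p⊆p∪q F y∈K)) (contr-flat-disjoint M K-flat y∈K)) ,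
      x , x∈p∧x∉q⇒x∈p─q x∈H (x∉K∪F ∘ q⊆p∪q K F) , x∉K∪F ∘ p⊆p∪q F

    covers⁻ : ∀ {K G} → IsFlat C K → Covers C K G → Covers M (K ∪ F) (G ∪ F)
    covers⁻ {K} {G} K-flat (G-flat , K⊂G , minimal) = proj₁ (contr-flat⁻ M G-flat) , ∪F-⊂ G-flat K⊂G , minimal′
      where
      minimal′ : ∀ H → IsFlat M H → K ∪ F ⊂ H → H ⊆ G ∪ F → H ≡ G ∪ F
      minimal′ H H-flat K∪F⊂H H⊆G∪F =
        trans (sym (p─q∪q≡p F⊆H)) (cong (_∪ F) (minimal (H ─ F) (flat-─ H-flat F⊆H) (─F-⊂ K-flat K∪F⊂H) H─F⊆G))
        where
        F⊆H : F ⊆ H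
        F⊆H = ⊆-trans (q⊆p∪q K F) (p⊂q⇒p⊆q K∪F⊂H)
        H─F⊆G : H ─ F ⊆ G
        H─F⊆G x∈H─F with x∈p─q⁻ H F x∈H─F
        ... | x∈H , x∉F with x∈p∪q⁻ G F (H⊆G∪F x∈H)
        ...   | inj₁ x∈G = x∈G
        ...   | inj₂ x∈F = contradiction x∈F x∉F

    covers⁺ : ∀ {K G} → IsFlat C K → Covers M (K ∪ F) G → Covers C K (G ─ F)
    covers⁺ {K} {G} K-flat (G-flat , K∪F⊂G , minimal) = flat-─ G-flat F⊆G , ─F-⊂ K-flat K∪F⊂G , minimal′
      where
      F⊆G : F ⊆ G
      F⊆G = ⊆-trans (q⊆p∪q K F) (p⊂q⇒p⊆q K∪F⊂G)
      minimal′ : ∀ H → IsFlat C H → K ⊂ H → H ⊆ G ─ F → H ≡ G ─ F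
      minimal′ H H-flat K⊂H H⊆G─F =
        trans (sym (p∪q─q≡p (contr-flat-disjoint M H-flat))) (cong (_─ F) H∪F≡G)
        where
        H∪F⊆G : H ∪ F ⊆ G
        H∪F⊆G x∈ with x∈p∪q⁻ H F x∈
        ... | inj₁ x∈H = p─q⊆p G F (H⊆G─F x∈H)
        ... | inj₂ x∈F = F⊆G x∈F
        H∪F≡G : H ∪ F ≡ G
        H∪F≡G = minimal (H ∪ F) (proj₁ (contr-flat⁻ M H-flat)) (∪F-⊂ H-flat K⊂H) H∪F⊆G

    isMatroid : IsMatroid C
    isMatroid = record
      { flat⊆ground = λ X X-flat → proj₂ (contr-flat⁻ M X-flat)
      ; F1 = contr-flat⁺ M (subst (IsFlat M) (sym (p─q∪q≡p F⊆E)) F1) ⊆-refl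
      ; F2 = λ X Y X-flat Y-flat →
          contr-flat⁺ M (subst (IsFlat M) (sym (∪-distribʳ-∩ F X Y))
                          (F2 _ _ (proj₁ (contr-flat⁻ M X-flat)) (proj₁ (contr-flat⁻ M Y-flat))))
                        (⊆-trans (p∩q⊆p X Y) (proj₂ (contr-flat⁻ M X-flat)))
      ; F3-exists = λ K K-flat x x∈E─F x∉K →
          let (G , G-covers , x∈G) = F3-exists (K ∪ F) (proj₁ (contr-flat⁻ M K-flat)) x
                                       (proj₁ (x∈p─q⁻ E F x∈E─F)) (x∉K∪F K x∈E─F x∉K)
          in G ─ F , covers⁺ K-flat G-covers , x∈p∧x∉q⇒x∈p─q x∈G (proj₂ (x∈p─q⁻ E F x∈E─F))
      ; F3-unique = λ K K-flat x x∈E─F x∉K G G′ G-covers G′-covers x∈G x∈G′ →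
          trans (sym (p∪q─q≡p (contr-flat-disjoint M (proj₁ G-covers))))
            (trans (cong (_─ F) (F3-unique (K ∪ F) (proj₁ (contr-flat⁻ M K-flat)) x (proj₁ (x∈p─q⁻ E F x∈E─F))
                                   (x∉K∪F K x∈E─F x∉K) (G ∪ F) (G′ ∪ F)
                                   (covers⁻ K-flat G-covers) (covers⁻ K-flat G′-covers)
                                   (p⊆p∪q F x∈G) (p⊆p∪q F x∈G′)))
                   (p∪q─q≡p (contr-flat-disjoint M (proj₁ G′-covers))))
      }
      where
      x∉K∪F : ∀ K {x} → x ∈ E ─ F → x ∉ K → x ∉ K ∪ F
      x∉K∪F K {x} x∈E─F x∉K x∈ with x∈p∪q⁻ K F x∈
      ... | inj₁ x∈K = x∉K x∈K
      ... | inj₂ x∈F = proj₂ (x∈p─q⁻ E F x∈E─F) x∈F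

    ⊥-flat-C : IsFlat C ⊥
    ⊥-flat-C = contr-flat⁺ M (subst (IsFlat M) (sym (∪-identityˡ F)) F-flat) ⊥⊆

    loopless : Loopless C
    loopless = ⊥-flat⇒loopless C ⊥-flat-C

    covers-⊥ : ∀ {H} → Covers M F H → Covers C ⊥ (H ─ F)
    covers-⊥ {H} F⋖H = covers⁺ ⊥-flat-C (subst (λ Z → Covers M Z H) (sym (∪-identityˡ F)) F⋖H)

-- Flats are Boolean functions, so minors of minors agree with minors only pointwise.
infix 4 _≈M_

record _≈M_ (N N′ : RawMat n) : Set where
  field
    ground-≡ : ground N ≡ ground N′
    flat-≡ : ∀ X → flat N X ≡ flat N′ X
open _≈M_

module _ {N N′ : RawMat n} (N≈N′ : N ≈M N′) where

  ≈M-sym : N′ ≈M N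
  ≈M-sym = record { ground-≡ = sym (ground-≡ N≈N′) ; flat-≡ = λ X → sym (flat-≡ N≈N′ X) }

  ≈M-hat0 : hat0 N ≡ hat0 N′
  ≈M-hat0 = cong₂ (foldr _∩_) (ground-≡ N≈N′) (filterᵇ-cong (flat-≡ N≈N′) (allSubsets _))

  ≈M-loopless : Loopless N → Loopless N′
  ≈M-loopless = trans (sym ≈M-hat0)

  ≈M-inPᵇ : ∀ X → inPᵇ N X ≡ inPᵇ N′ X
  ≈M-inPᵇ X = cong₂ _∧_ (flat-≡ N≈N′ X)
    (cong₂ (λ Z E → not (eqᵇ X Z) ∧ not (eqᵇ X E)) ≈M-hat0 (ground-≡ N≈N′))

  ≈M-Plist : Plist N ≡ Plist N′
  ≈M-Plist = filterᵇ-cong ≈M-inPᵇ (allSubsets _)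

  ≈M-restrictV : ∀ t X → restrictV N t X ≡ restrictV N′ t X
  ≈M-restrictV t X = cong (λ b → if b then t X else 0ℚ) (≈M-inPᵇ X)

  ≈M-restr : ∀ F → restr N F ≈M restr N′ F
  ≈M-restr F = record { ground-≡ = refl ; flat-≡ = λ X → cong (_∧ ⊆ᵇ X F) (flat-≡ N≈N′ X) }

  ≈M-contr : ∀ F → contr N F ≈M contr N′ F
  ≈M-contr F = record
    { ground-≡ = cong (_─ F) (ground-≡ N≈N′)
    ; flat-≡ = λ X → cong₂ (λ b E → b ∧ ⊆ᵇ X (E ─ F)) (flat-≡ N≈N′ (X ∪ F)) (ground-≡ N≈N′)
    }

  ≈M-Covers : ∀ {A B} → Covers N A B → Covers N′ A B
  ≈M-Covers {B = B} (B-flat , A⊂B , minimal) =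
    trans (sym (flat-≡ N≈N′ B)) B-flat , A⊂B , λ H H-flat → minimal H (trans (flat-≡ N≈N′ H) H-flat)

  ≈M-HasRank : ∀ {k} → HasRank N k → HasRank N′ k
  ≈M-HasRank {k} rank = subst₂ (λ A B → CoverChain N′ A B k) ≈M-hat0 (ground-≡ N≈N′) (transport rank)
    where
    transport : ∀ {A B k} → CoverChain N A B k → CoverChain N′ A B k
    transport (here F) = here F
    transport (step A-covers chain) = step (≈M-Covers A-covers) (transport chain)

  ≈M-isMatroid : IsMatroid N → IsMatroid N′
  ≈M-isMatroid N-matroid = record
    { flat⊆ground = λ X X-flat → subst (X ⊆_) (ground-≡ N≈N′) (flat⊆ground X (flat⁻ X-flat))
    ; F1 = trans (sym (flat-≡ N≈N′ (ground N′))) (subst (IsFlat N) (ground-≡ N≈N′) F1)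
    ; F2 = λ X Y X-flat Y-flat → trans (sym (flat-≡ N≈N′ (X ∩ Y))) (F2 X Y (flat⁻ X-flat) (flat⁻ Y-flat))
    ; F3-exists = λ K K-flat x x∈E x∉K →
        let (G , G-covers , x∈G) = F3-exists K (flat⁻ K-flat) x (subst (x ∈_) (sym (ground-≡ N≈N′)) x∈E) x∉K
        in G , ≈M-Covers G-covers , x∈G
    ; F3-unique = λ K K-flat x x∈E x∉K G G′ G-covers G′-covers →
        F3-unique K (flat⁻ K-flat) x (subst (x ∈_) (sym (ground-≡ N≈N′)) x∈E) x∉K G G′
                  (≈M-Covers⁻ G-covers) (≈M-Covers⁻ G′-covers)
    }
    where
    open IsMatroid N-matroid
    flat⁻ : ∀ {X} → IsFlat N′ X → IsFlat N X
    flat⁻ {X} = trans (flat-≡ N≈N′ X)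
    ≈M-Covers⁻ : ∀ {A B} → Covers N′ A B → Covers N A B
    ≈M-Covers⁻ {B = B} (B-flat , A⊂B , minimal) =
      flat⁻ B-flat , A⊂B , λ H H-flat → minimal H (trans (sym (flat-≡ N≈N′ H)) H-flat)

  ≈M-αL : ∀ X → αL N X ≡ αL N′ X
  ≈M-αL X with pick (ground N) | pick (ground N′) | cong pick (ground-≡ N≈N′)
  ... | just i | just .i | refl = cong (λ b → if b ∧ lookup X i then 1ℚ else 0ℚ) (≈M-inPᵇ X)
  ... | nothing | nothing | refl = refl

  ≈M-βL : ∀ X → βL N X ≡ βL N′ X
  ≈M-βL X with pick (ground N) | pick (ground N′) | cong pick (ground-≡ N≈N′)
  ... | just i | just .i | refl = cong (λ b → if b ∧ not (lookup X i) then 1ℚ else 0ℚ) (≈M-inPᵇ X)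
  ... | nothing | nothing | refl = refl

lincomb-cong : ∀ (L : List (Subset n)) {t t′ f f′} X → (∀ G → G ∈ˡ L → t G ≡ t′ G) →
  (∀ G → G ∈ˡ L → f G X ≡ f′ G X) → lincomb L t f X ≡ lincomb L t′ f′ X
lincomb-cong [] X t≗t′ f≗f′ = refl
lincomb-cong (G ∷ L) X t≗t′ f≗f′ =
  cong₂ _+_ (cong₂ _*_ (t≗t′ G (here refl)) (f≗f′ G (here refl)))
            (lincomb-cong L X (λ H H∈L → t≗t′ H (there H∈L)) (λ H H∈L → f≗f′ H (there H∈L)))

module _ {N N′ : RawMat n} (N≈N′ : N ≈M N′) where

  ≈M-πUp : ∀ F {t t′} → (∀ G → InP N G → t G ≡ t′ G) → ∀ X → πUp N F t X ≡ πUp N′ F t′ X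
  ≈M-πUp F {t} {t′} t≗t′ X =
    trans (lincomb-cong (Plist N) X (λ G G∈L → t≗t′ G (∈-Plist⁻ N G∈L)) (λ G _ → imgUp-≡ G))
          (cong (λ L → lincomb L t′ (imgUp N′ F) X) (≈M-Plist N≈N′))
    where
    imgUp-≡ : ∀ G → imgUp N F G X ≡ imgUp N′ F G X
    imgUp-≡ G with ⊊ᵇ G F
    ... | true = refl
    ... | false with eqᵇ G F
    ...   | true = cong -_ (≈M-αL (≈M-restr N≈N′ F) X)
    ...   | false = refl

  ≈M-πDown : ∀ F {t t′} → (∀ G → InP N G → t G ≡ t′ G) → ∀ X → πDown N F t X ≡ πDown N′ F t′ X
  ≈M-πDown F {t} {t′} t≗t′ X =
    trans (lincomb-cong (Plist N) X (λ G G∈L → t≗t′ G (∈-Plist⁻ N G∈L)) (λ G _ → imgDown-≡ G))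
          (cong (λ L → lincomb L t′ (imgDown N′ F) X) (≈M-Plist N≈N′))
    where
    imgDown-≡ : ∀ G → imgDown N F G X ≡ imgDown N′ F G X
    imgDown-≡ G with ⊊ᵇ F G
    ... | true = refl
    ... | false with eqᵇ G F
    ...   | true = cong -_ (≈M-βL (≈M-contr N≈N′ F) X)
    ...   | false = refl

evalOn-cong : ∀ (N : RawMat n) p {t t′} → (∀ X → InP N X → t X ≡ t′ X) → evalOn N p t ≡ evalOn N p t′
evalOn-cong N p {t} {t′} t≗t′ = eval-cong restrictV-≡ p
  where
  restrictV-≡ : ∀ X → restrictV N t X ≡ restrictV N t′ X
  restrictV-≡ X with inPᵇ N X in X∈P
  ... | true = t≗t′ X X∈P
  ... | false = refl

-- The axioms determine the volume polynomial as a function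

volume : (RawMat n → Poly n) → RawMat n → Vect n → ℚ
volume V N = evalOn N (V N)

module Volume {n} (V : RawMat n → Poly n) (V-volume : IsVolumeFamily V) where

  volume-rank1 : ∀ N → IsMatroid N → Loopless N → HasRank N 1 → ∀ t → volume V N t ≡ 1ℚ
  volume-rank1 N N-matroid N-loopless = proj₁ (V-volume N N-matroid N-loopless)

  volume-zero : ∀ N → IsMatroid N → Loopless N → ∀ r → HasRank N (suc (suc r)) → volume V N zeroV ≡ 0ℚ
  volume-zero N N-matroid N-loopless = proj₁ (proj₂ (V-volume N N-matroid N-loopless))

  volume-∂ : ∀ N → IsMatroid N → Loopless N → ∀ r → HasRank N (suc r) → ∀ F → InP N F → ∀ t →
    evalOn N (∂ F (V N)) t ≡ volume V (restr N F) (πUp N F t) * volume V (contr N F) (πDown N F t)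
  volume-∂ N N-matroid N-loopless = proj₂ (proj₂ (V-volume N N-matroid N-loopless))

  VolumeInvariant : RawMat n → Set
  VolumeInvariant N = ∀ {N′} → N ≈M N′ → ∀ t → volume V N t ≡ volume V N′ t

  volume-≈M-rank1 : ∀ {N} → IsMatroid N → Loopless N → HasRank N 1 → VolumeInvariant N
  volume-≈M-rank1 {N} N-matroid N-loopless rank N≈N′ t =
    trans (volume-rank1 N N-matroid N-loopless rank t)
          (sym (volume-rank1 _ (≈M-isMatroid N≈N′ N-matroid) (≈M-loopless N≈N′ N-loopless) (≈M-HasRank N≈N′ rank) t))

  -- The partials of V_N - V_N′ are products of volumes of minors, so they vanish, and so does V_N - V_N′ at 0.
  volume-≈M-from-minors : ∀ {N} → IsMatroid N → Loopless N → ∀ r → HasRank N (suc (suc r)) →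
    (∀ G → InP N G → VolumeInvariant (restr N G) × VolumeInvariant (contr N G)) → VolumeInvariant N
  volume-≈M-from-minors {N} N-matroid N-loopless r rank minors {N′} N≈N′ t =
    trans (p-q≡0⇒p≡q _ _ difference-vanishes) (eval-cong (≈M-restrictV N≈N′ t) (V N′))
    where
    N′-matroid : IsMatroid N′
    N′-matroid = ≈M-isMatroid N≈N′ N-matroid
    N′-loopless : Loopless N′
    N′-loopless = ≈M-loopless N≈N′ N-loopless
    ∂-agree : ∀ G → InP N G → ∀ s → evalOn N (∂ G (V N)) s ≡ evalOn N (∂ G (V N′)) s
    ∂-agree G G∈P s = begin
      evalOn N (∂ G (V N)) s
        ≡⟨ volume-∂ N N-matroid N-loopless (suc r) rank G G∈P s ⟩
      volume V (restr N G) (πUp N G s) * volume V (contr N G) (πDown N G s)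
        ≡⟨ cong₂ _*_ (trans (proj₁ (minors G G∈P) (≈M-restr N≈N′ G) (πUp N G s))
                            (evalOn-cong (restr N′ G) (V (restr N′ G)) (λ X _ → ≈M-πUp N≈N′ G (λ _ _ → refl) X)))
                     (trans (proj₂ (minors G G∈P) (≈M-contr N≈N′ G) (πDown N G s))
                            (evalOn-cong (contr N′ G) (V (contr N′ G)) (λ X _ → ≈M-πDown N≈N′ G (λ _ _ → refl) X))) ⟩
      volume V (restr N′ G) (πUp N′ G s) * volume V (contr N′ G) (πDown N′ G s)
        ≡⟨ volume-∂ N′ N′-matroid N′-loopless (suc r) (≈M-HasRank N≈N′ rank) G
             (trans (sym (≈M-inPᵇ N≈N′ G)) G∈P) s ⟨
      evalOn N′ (∂ G (V N′)) s
        ≡⟨ eval-cong (≈M-restrictV N≈N′ s) (∂ G (V N′)) ⟨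
      evalOn N (∂ G (V N′)) s ∎
    ∂-vanishes : ∀ G → InP N G → ∀ s → evalOn N (∂ G (V N ⊖ V N′)) s ≡ 0ℚ
    ∂-vanishes G G∈P s = trans (eval-∂-⊖ (restrictV N s) G (V N) (V N′)) (p≡q⇒p-q≡0 (∂-agree G G∈P s))
    difference-vanishes : evalOn N (V N) t - evalOn N (V N′) t ≡ 0ℚ
    difference-vanishes = begin
      evalOn N (V N) t - evalOn N (V N′) t  ≡⟨ eval-⊖ (restrictV N t) (V N) (V N′) ⟨
      evalOn N (V N ⊖ V N′) t               ≡⟨ ∂-vanishing⇒constant N (V N ⊖ V N′) ∂-vanishes t ⟩
      evalOn N (V N ⊖ V N′) zeroV           ≡⟨ eval-⊖ (restrictV N zeroV) (V N) (V N′) ⟩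
      volume V N zeroV - evalOn N (V N′) zeroV
        ≡⟨ cong₂ _-_ (volume-zero N N-matroid N-loopless r rank)
             (trans (eval-cong (≈M-restrictV N≈N′ zeroV) (V N′))
                    (volume-zero N′ N′-matroid N′-loopless r (≈M-HasRank N≈N′ rank))) ⟩
      0ℚ - 0ℚ                               ≡⟨ p≡q⇒p-q≡0 {0ℚ} refl ⟩
      0ℚ                                    ∎

  -- Induction on the size of the ground set: proper minors are smaller.
  volume-≈M : ∀ {N} → IsMatroid N → Loopless N → ground N ≢ ⊥ → VolumeInvariant N
  volume-≈M {N} = go (suc ∣ ground N ∣) N (ℕ.n<1+n _)
    where
    go : ∀ k N → ∣ ground N ∣ ℕ.< k → IsMatroid N → Loopless N → ground N ≢ ⊥ → VolumeInvariant N
    go (suc k) N (s≤s ∣E∣≤k) N-matroid N-loopless E≢⊥ with Matroid.rank-exists N N-matroid N-loopless E≢⊥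
    ... | zero , rank = volume-≈M-rank1 N-matroid N-loopless rank
    ... | suc r , rank = volume-≈M-from-minors N-matroid N-loopless r rank minors
      where
      minors : ∀ G → InP N G → VolumeInvariant (restr N G) × VolumeInvariant (contr N G)
      minors G G∈P =
        go k (restr N G) (ℕ.<-≤-trans (p⊂q⇒∣p∣<∣q∣ G⊂E) ∣E∣≤k)
           R.isMatroid (R.loopless N-loopless) (⊂⇒≢⊥ ⊥⊂G) ,
        go k (contr N G) (ℕ.<-≤-trans (p∩q≢∅⇒∣p─q∣<∣p∣ (ground N) G E∩G-nonempty) ∣E∣≤k)
           C.isMatroid C.loopless (∈⇒≢⊥ (proj₂ (⊂⇒∃∈─ G⊂E)))
        where
        G-info : IsFlat N G × ⊥ ⊂ G × G ⊂ ground N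
        G-info = Matroid.InP⁻ N N-matroid N-loopless G∈P
        G-flat : IsFlat N G
        G-flat = proj₁ G-info
        ⊥⊂G : ⊥ ⊂ G
        ⊥⊂G = proj₁ (proj₂ G-info)
        G⊂E : G ⊂ ground N
        G⊂E = proj₂ (proj₂ G-info)
        module R = Matroid.Restriction N N-matroid G G-flat
        module C = Matroid.Contraction N N-matroid G G-flat
        E∩G-nonempty : Nonempty (ground N ∩ G)
        E∩G-nonempty with ⊂⇒∃∈─ ⊥⊂G
        ... | x , x∈G─⊥ = let x∈G = p─q⊆p G ⊥ x∈G─⊥ in x , x∈p∩q⁺ (p⊂q⇒p⊆q G⊂E x∈G , x∈G)

-- Composing polynomials with linear maps

substitute : Poly n → (Subset n → Poly n) → Poly n
substitute (con c) σ = con c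
substitute (var X) σ = σ X
substitute (p ⊕ q) σ = substitute p σ ⊕ substitute q σ
substitute (p ⊗ q) σ = substitute p σ ⊗ substitute q σ

eval-substitute : ∀ (s : Vect n) p σ → eval s (substitute p σ) ≡ eval (λ Y → eval s (σ Y)) p
eval-substitute s (con c) σ = refl
eval-substitute s (var X) σ = refl
eval-substitute s (p ⊕ q) σ = cong₂ _+_ (eval-substitute s p σ) (eval-substitute s q σ)
eval-substitute s (p ⊗ q) σ = cong₂ _*_ (eval-substitute s p σ) (eval-substitute s q σ)

∂-substitute-const : ∀ (s : Vect n) H σ → (∀ Y → eval s (∂ H (σ Y)) ≡ 0ℚ) →
  ∀ p → eval s (∂ H (substitute p σ)) ≡ 0ℚ
∂-substitute-const s H σ ∂σ≡0 (con c) = refl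
∂-substitute-const s H σ ∂σ≡0 (var X) = ∂σ≡0 X
∂-substitute-const s H σ ∂σ≡0 (p ⊕ q) =
  trans (cong₂ _+_ (∂-substitute-const s H σ ∂σ≡0 p) (∂-substitute-const s H σ ∂σ≡0 q)) (+-identityˡ 0ℚ)
∂-substitute-const s H σ ∂σ≡0 (p ⊗ q) =
  trans (cong₂ (λ a b → a * eval s (substitute q σ) + eval s (substitute p σ) * b)
               (∂-substitute-const s H σ ∂σ≡0 p) (∂-substitute-const s H σ ∂σ≡0 q))
        (trans (cong₂ _+_ (*-zeroˡ (eval s (substitute q σ))) (*-zeroʳ (eval s (substitute p σ)))) (+-identityˡ 0ℚ))

∂-substitute-δ : ∀ (s : Vect n) H H′ σ → (∀ Y → eval s (∂ H (σ Y)) ≡ 𝟙 (eqᵇ H′ Y)) →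
  ∀ p → eval s (∂ H (substitute p σ)) ≡ eval (λ Y → eval s (σ Y)) (∂ H′ p)
∂-substitute-δ s H H′ σ ∂σ≡δ (con c) = refl
∂-substitute-δ s H H′ σ ∂σ≡δ (var X) with ∂σ≡δ X
... | ∂σX≡δ with eqᵇ H′ X
...   | true = ∂σX≡δ
...   | false = ∂σX≡δ
∂-substitute-δ s H H′ σ ∂σ≡δ (p ⊕ q) = cong₂ _+_ (∂-substitute-δ s H H′ σ ∂σ≡δ p) (∂-substitute-δ s H H′ σ ∂σ≡δ q)
∂-substitute-δ s H H′ σ ∂σ≡δ (p ⊗ q) =
  cong₂ _+_ (cong₂ _*_ (∂-substitute-δ s H H′ σ ∂σ≡δ p) (eval-substitute s q σ))
            (cong₂ _*_ (eval-substitute s p σ) (∂-substitute-δ s H H′ σ ∂σ≡δ q))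

linearForm : List (Subset n) → (Subset n → ℚ) → Poly n
linearForm [] c = con 0ℚ
linearForm (G ∷ L) c = (var G ⊗ con (c G)) ⊕ linearForm L c

-- the coordinates, on 𝒫(N), of the linear map t ↦ Σ_{G ∈ 𝒫(M)} t_G img_G
linearMap : RawMat n → RawMat n → (Subset n → Vect n) → Subset n → Poly n
linearMap M N img Y = if inPᵇ N Y then linearForm (Plist M) (λ G → img G Y) else con 0ℚ

pullback : RawMat n → RawMat n → (Subset n → Vect n) → Poly n → Poly n
pullback M N img p = substitute p (linearMap M N img)

eval-linearMap : ∀ (M N : RawMat n) img t Y →
  eval (restrictV M t) (linearMap M N img Y) ≡ restrictV N (lincomb (Plist M) t img) Y
eval-linearMap M N img t Y with inPᵇ N Y
... | true = trans (eval-linearForm (Plist M) (λ G → ∈-Plist⁻ M)) (sym (lincomb≡∑ (Plist M) t img Y))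
  where
  eval-linearForm : ∀ L → (∀ G → G ∈ˡ L → InP M G) →
    eval (restrictV M t) (linearForm L (λ G → img G Y)) ≡ ∑ L (λ G → t G * img G Y)
  eval-linearForm [] _ = refl
  eval-linearForm (G ∷ L) L⊆P =
    cong₂ _+_ (cong (λ b → (if b then t G else 0ℚ) * img G Y) (L⊆P G (here refl)))
              (eval-linearForm L (λ H H∈L → L⊆P H (there H∈L)))
... | false = refl

evalOn-pullback : ∀ (M N : RawMat n) img p t → evalOn M (pullback M N img p) t ≡ evalOn N p (lincomb (Plist M) t img)
evalOn-pullback M N img p t =
  trans (eval-substitute (restrictV M t) p (linearMap M N img)) (eval-cong (eval-linearMap M N img t) p)

∂-linearMap : ∀ (M N : RawMat n) img s {H} → InP M H → ∀ Y →
  eval s (∂ H (linearMap M N img Y)) ≡ (if inPᵇ N Y then img H Y else 0ℚ)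
∂-linearMap M N img s {H} H∈P Y with inPᵇ N Y
... | true = trans (∂-linearForm (Plist M) (λ G → img G Y)) (∑-Plist-δ M (λ G → img G Y) H∈P)
  where
  ∂-linearForm : ∀ L c → eval s (∂ H (linearForm L c)) ≡ ∑ L (λ G → 𝟙 (eqᵇ H G) * c G)
  ∂-linearForm [] c = refl
  ∂-linearForm (G ∷ L) c = cong₂ _+_ ∂-term (∂-linearForm L c)
    where
    ∂-term : eval s (∂ H (var G)) * c G + s G * 0ℚ ≡ 𝟙 (eqᵇ H G) * c G
    ∂-term with eqᵇ H G
    ... | true = trans (cong (1ℚ * c G +_) (*-zeroʳ (s G))) (+-identityʳ _)
    ... | false = trans (cong (0ℚ * c G +_) (*-zeroʳ (s G))) (+-identityʳ _)
... | false = refl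

foldr-∂-⊗-const : ∀ (M : RawMat n) {Gs} → All (InP M) Gs → ∀ P Q → All (λ G → ∀ t → evalOn M (∂ G P) t ≡ 0ℚ) Gs →
  ∀ t → evalOn M (foldr ∂ (P ⊗ Q) Gs) t ≡ evalOn M P t * evalOn M (foldr ∂ Q Gs) t
foldr-∂-⊗-const M [] P Q [] t = refl
foldr-∂-⊗-const {n = n} M {G ∷ Gs} (G∈P ∷ Gs⊆P) P Q (∂P≡0 ∷ ∂sP≡0) t = begin
  evalOn M (∂ G (foldr ∂ (P ⊗ Q) Gs)) t
    ≡⟨ ∂-cong M G∈P (foldr ∂ (P ⊗ Q) Gs) (P ⊗ foldr ∂ Q Gs) (foldr-∂-⊗-const M Gs⊆P P Q ∂sP≡0) t ⟩
  evalOn M (∂ G P) t * evalOn M Q′ t + evalOn M P t * evalOn M (∂ G Q′) t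
    ≡⟨ cong (λ a → a * evalOn M Q′ t + evalOn M P t * evalOn M (∂ G Q′) t) (∂P≡0 t) ⟩
  0ℚ * evalOn M Q′ t + evalOn M P t * evalOn M (∂ G Q′) t
    ≡⟨ trans (cong (_+ evalOn M P t * evalOn M (∂ G Q′) t) (*-zeroˡ (evalOn M Q′ t))) (+-identityˡ _) ⟩
  evalOn M P t * evalOn M (∂ G Q′) t ∎
  where
  Q′ : Poly n
  Q′ = foldr ∂ Q Gs

contr-contr : ∀ (M : RawMat n) {F G} → F ⊆ G → G ⊆ ground M → contr (contr M F) (G ─ F) ≈M contr M G
contr-contr {n = n} M {F} {G} F⊆G G⊆E = record
  { ground-≡ = r─p─[q─p]≡r─q (ground M) F⊆G
  ; flat-≡ = flat-≡′
  }
  where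
  E : Subset n
  E = ground M
  absorb : ∀ a b c → (c ≡ true → b ≡ true) → (a ∧ b) ∧ c ≡ a ∧ c
  absorb a b false _ = trans (∧-zeroʳ (a ∧ b)) (sym (∧-zeroʳ a))
  absorb a b true c⇒b rewrite c⇒b refl = cong (_∧ true) (Bool.∧-identityʳ a)
  flat-≡′ : ∀ X → (flat M ((X ∪ (G ─ F)) ∪ F) ∧ ⊆ᵇ (X ∪ (G ─ F)) (E ─ F)) ∧ ⊆ᵇ X ((E ─ F) ─ (G ─ F))
                ≡ flat M (X ∪ G) ∧ ⊆ᵇ X (E ─ G)
  flat-≡′ X rewrite r∪[q─p]∪p≡r∪q X F⊆G | r─p─[q─p]≡r─q E F⊆G =
    absorb (flat M (X ∪ G)) _ _ (λ X⊆E─G → ⊆⇒⊆ᵇ _ _ (⊆E─F (⊆ᵇ⇒⊆ X (E ─ G) X⊆E─G)))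
    where
    ⊆E─F : X ⊆ E ─ G → X ∪ (G ─ F) ⊆ E ─ F
    ⊆E─F X⊆E─G x∈ with x∈p∪q⁻ X (G ─ F) x∈
    ... | inj₁ x∈X = let (x∈E , x∉G) = x∈p─q⁻ E G (X⊆E─G x∈X) in x∈p∧x∉q⇒x∈p─q x∈E (x∉G ∘ F⊆G)
    ... | inj₂ x∈G─F = let (x∈G , x∉F) = x∈p─q⁻ G F x∈G─F in x∈p∧x∉q⇒x∈p─q (G⊆E x∈G) x∉F

∉⇒lookup≡false : ∀ {X : Subset n} {x} → x ∉ X → lookup X x ≡ false
∉⇒lookup≡false {X = X} {x} x∉X with lookup X x in e
... | true = contradiction (lookup⇒[]= x X e) x∉X
... | false = refl

pick-∈ : ∀ (X : Subset n) {i} → pick X ≡ just i → i ∈ X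
pick-∈ (true ∷ X) refl = here
pick-∈ (false ∷ X) e with pick X in pick-X
pick-∈ (false ∷ X) refl | just j = there (pick-∈ X pick-X)

pick-nonempty : ∀ (X : Subset n) {x} → x ∈ X → ∃[ i ] pick X ≡ just i
pick-nonempty (true ∷ X) _ = zero , refl
pick-nonempty (false ∷ X) (there x∈X) with pick-nonempty X x∈X
... | j , pick-X rewrite pick-X = suc j , refl

pick-⊆ : ∀ (X Y : Subset n) {i} → pick X ≡ just i → Y ⊆ X → i ∈ Y → pick Y ≡ just i
pick-⊆ (true ∷ X) (true ∷ Y) refl Y⊆X here = refl
pick-⊆ (false ∷ X) (true ∷ Y) _ Y⊆X _ with Y⊆X here
... | ()
pick-⊆ (false ∷ X) (false ∷ Y) e Y⊆X i∈Y with pick X in pick-X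
pick-⊆ (false ∷ X) (false ∷ Y) refl Y⊆X (there j∈Y) | just j
  rewrite pick-⊆ X Y pick-X (drop-∷-⊆ Y⊆X) j∈Y = refl

βL-pick : ∀ (N : RawMat n) {i} → pick (ground N) ≡ just i → ∀ {Y} → InP N Y → βL N Y ≡ 𝟙 (not (lookup Y i))
βL-pick N e {Y} Y∈P with pick (ground N)
βL-pick N refl {Y} Y∈P | just i rewrite Y∈P = refl

module ContractionCoordinates (M : RawMat n) (M-matroid : IsMatroid M) (M-loopless : Loopless M) where
  open Matroid M M-matroid

  InP-─ : ∀ {F H} → IsFlat M F → IsFlat M H → F ⊂ H → H ⊂ E → InP (contr M F) (H ─ F)
  InP-─ {F} {H} F-flat H-flat F⊂H H⊂E =
    Matroid.InP⁺ (contr M F) C.isMatroid C.loopless (C.flat-─ H-flat (p⊂q⇒p⊆q F⊂H))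
      (⊆∧≢⇒⊂ ⊥⊆ (≢-sym (∈⇒≢⊥ (proj₂ (⊂⇒∃∈─ F⊂H))))) (─-monoˡ-⊂ (p⊂q⇒p⊆q F⊂H) H⊂E)
    where
    module C = Contraction F F-flat

  module _ {K} (K∈P : InP M K) {X} (X∈P : InP (contr M K) X) where
    private
      K-info : IsFlat M K × ⊥ ⊂ K × K ⊂ E
      K-info = InP⁻ M-loopless K∈P
      K-flat : IsFlat M K
      K-flat = proj₁ K-info
      module C = Contraction K K-flat
      X-info : IsFlat (contr M K) X × ⊥ ⊂ X × X ⊂ E ─ K
      X-info = Matroid.InP⁻ (contr M K) C.isMatroid C.loopless X∈P
      X-disjoint : Disjoint X K
      X-disjoint = contr-flat-disjoint M (proj₁ X-info)
      b : ℚ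
      b = βL (contr M K) X
      K⊂X∪K : K ⊂ X ∪ K
      K⊂X∪K with ⊂⇒∃∈─ (proj₁ (proj₂ X-info))
      ... | x , x∈X─⊥ = q⊆p∪q X K , x , p⊆p∪q K (proj₁ (x∈p─q⁻ X ⊥ x∈X─⊥)) ,
                        X-disjoint (proj₁ (x∈p─q⁻ X ⊥ x∈X─⊥))

    X∪K∈P : InP M (X ∪ K)
    X∪K∈P = InP⁺ M-loopless (proj₁ (contr-flat⁻ M (proj₁ X-info)))
      (⊂-⊆-trans (proj₁ (proj₂ K-info)) (q⊆p∪q X K))
      (⊆∧≢⇒⊂ X∪K⊆E (λ X∪K≡E → ⊂⇒≢ (proj₂ (proj₂ X-info)) (trans (sym (p∪q─q≡p X-disjoint)) (cong (_─ K) X∪K≡E))))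
      where
      X∪K⊆E : X ∪ K ⊆ E
      X∪K⊆E x∈ with x∈p∪q⁻ X K x∈
      ... | inj₁ x∈X = p─q⊆p E K (proj₂ (contr-flat⁻ M (proj₁ X-info)) x∈X)
      ... | inj₂ x∈K = C.F⊆E x∈K

    imgDown-coordinate : ∀ Y → imgDown M K Y X ≡ 𝟙 (eqᵇ (X ∪ K) Y) - 𝟙 (eqᵇ K Y) * βL (contr M K) X
    imgDown-coordinate Y with ⊊ᵇ K Y in K⊊Y
    ... | true = begin
      𝟙 (eqᵇ (Y ─ K) X)                       ≡⟨ cong 𝟙 Y─K=X⇔X∪K=Y ⟩
      𝟙 (eqᵇ (X ∪ K) Y)                       ≡⟨ ring (𝟙 (eqᵇ (X ∪ K) Y)) b ⟩
      𝟙 (eqᵇ (X ∪ K) Y) - 𝟙 false * b         ≡⟨ cong (λ c → 𝟙 (eqᵇ (X ∪ K) Y) - 𝟙 c * b) K≠Y ⟨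
      𝟙 (eqᵇ (X ∪ K) Y) - 𝟙 (eqᵇ K Y) * b     ∎
      where
      K⊂Y : K ⊂ Y
      K⊂Y = ⊊ᵇ⇒⊂ K Y K⊊Y
      K≠Y : eqᵇ K Y ≡ false
      K≠Y = ≢⇒eqᵇ≡false K Y (⊂⇒≢ K⊂Y)
      Y─K=X⇔X∪K=Y : eqᵇ (Y ─ K) X ≡ eqᵇ (X ∪ K) Y
      Y─K=X⇔X∪K=Y with eqᵇ (X ∪ K) Y in X∪K=Y
      ... | true = ≡⇒eqᵇ (trans (cong (_─ K) (sym (eqᵇ⇒≡ _ _ X∪K=Y))) (p∪q─q≡p X-disjoint))
      ... | false = ≢⇒eqᵇ≡false _ _ λ Y─K≡X →
        eqᵇ≡false⇒≢ X∪K=Y (trans (cong (_∪ K) (sym Y─K≡X)) (p─q∪q≡p (p⊂q⇒p⊆q K⊂Y)))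
      ring : ∀ a b → a ≡ a - 0ℚ * b
      ring = solve-∀ ℚ-ring
    ... | false with eqᵇ Y K in Y=K
    ...   | true = begin
      - b                                     ≡⟨ ring b ⟩
      𝟙 false - 𝟙 true * b                    ≡⟨ cong₂ (λ c d → 𝟙 c - 𝟙 d * b) X∪K≠K (eqᵇ-refl K) ⟨
      𝟙 (eqᵇ (X ∪ K) K) - 𝟙 (eqᵇ K K) * b     ≡⟨ cong (λ Z → 𝟙 (eqᵇ (X ∪ K) Z) - 𝟙 (eqᵇ K Z) * b) (eqᵇ⇒≡ Y K Y=K) ⟨
      𝟙 (eqᵇ (X ∪ K) Y) - 𝟙 (eqᵇ K Y) * b     ∎
      where
      X∪K≠K : eqᵇ (X ∪ K) K ≡ false
      X∪K≠K = ≢⇒eqᵇ≡false (X ∪ K) K (≢-sym (⊂⇒≢ K⊂X∪K))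
      ring : ∀ b → - b ≡ 0ℚ - 1ℚ * b
      ring = solve-∀ ℚ-ring
    ...   | false = begin
      0ℚ                                      ≡⟨ ring b ⟩
      𝟙 false - 𝟙 false * b                   ≡⟨ cong₂ (λ c d → 𝟙 c - 𝟙 d * b) X∪K≠Y (trans (eqᵇ-sym K Y) Y=K) ⟨
      𝟙 (eqᵇ (X ∪ K) Y) - 𝟙 (eqᵇ K Y) * b     ∎
      where
      X∪K≠Y : eqᵇ (X ∪ K) Y ≡ false
      X∪K≠Y = ≢⇒eqᵇ≡false (X ∪ K) Y λ X∪K≡Y →
        contradiction (trans (sym K⊊Y) (⊂⇒⊊ᵇ K Y (subst (K ⊂_) X∪K≡Y K⊂X∪K))) λ ()
      ring : ∀ b → 0ℚ ≡ 0ℚ - 0ℚ * b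
      ring = solve-∀ ℚ-ring

    πDown-coordinate : ∀ t → πDown M K t X ≡ t (X ∪ K) - t K * βL (contr M K) X
    πDown-coordinate t = begin
      πDown M K t X
        ≡⟨ lincomb≡∑ (Plist M) t (imgDown M K) X ⟩
      ∑ (Plist M) (λ Y → t Y * imgDown M K Y X)
        ≡⟨ ∑-cong (Plist M) (λ Y _ → trans (cong (t Y *_) (imgDown-coordinate Y)) (ring (t Y) (𝟙 (eqᵇ (X ∪ K) Y)) (𝟙 (eqᵇ K Y)) b)) ⟩
      ∑ (Plist M) (λ Y → 𝟙 (eqᵇ (X ∪ K) Y) * t Y - 𝟙 (eqᵇ K Y) * (t Y * b))
        ≡⟨ ∑-- (Plist M) (λ Y → 𝟙 (eqᵇ (X ∪ K) Y) * t Y) (λ Y → 𝟙 (eqᵇ K Y) * (t Y * b)) ⟩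
      ∑ (Plist M) (λ Y → 𝟙 (eqᵇ (X ∪ K) Y) * t Y) - ∑ (Plist M) (λ Y → 𝟙 (eqᵇ K Y) * (t Y * b))
        ≡⟨ cong₂ _-_ (∑-Plist-δ M t X∪K∈P) (∑-Plist-δ M (λ Y → t Y * b) K∈P) ⟩
      t (X ∪ K) - t K * b ∎
      where
      ring : ∀ t a c b → t * (a - c * b) ≡ a * t - c * (t * b)
      ring = solve-∀ ℚ-ring

module TwoStepContraction (M : RawMat n) (M-matroid : IsMatroid M) (M-loopless : Loopless M)
  {F} (F∈P : InP M F) {G} (G-flat : IsFlat M G) (F⊂G : F ⊂ G) (G⊂E : G ⊂ ground M) where
  open Matroid M M-matroid
  open ContractionCoordinates M M-matroid M-loopless
  private
    F-info : IsFlat M F × ⊥ ⊂ F × F ⊂ E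
    F-info = InP⁻ M-loopless F∈P
    F-flat : IsFlat M F
    F-flat = proj₁ F-info
    module C = Contraction F F-flat
    M′ : RawMat n
    M′ = contr M F
    G₁ : Subset n
    G₁ = G ─ F
    F⊆G : F ⊆ G
    F⊆G = p⊂q⇒p⊆q F⊂G
    G∈P : InP M G
    G∈P = InP⁺ M-loopless G-flat (⊂-trans (proj₁ (proj₂ F-info)) F⊂G) G⊂E
    G₁∈P′ : InP M′ G₁
    G₁∈P′ = InP-─ F-flat G-flat F⊂G G⊂E
    M′≈ : contr M′ G₁ ≈M contr M G
    M′≈ = contr-contr M F⊆G (p⊂q⇒p⊆q G⊂E)
    module C′ = ContractionCoordinates M′ C.isMatroid C.loopless

  βL-contr-∪ : ∀ {X} → InP (contr M G) X → βL M′ (X ∪ G₁) ≡ βL M′ G₁ * βL (contr M G) X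
  βL-contr-∪ {X} X∈P with ⊂⇒∃∈─ (proj₂ (proj₂ F-info))
  ... | x , x∈E─F with pick-nonempty (E ─ F) x∈E─F
  ...   | i , pick-E─F with x∈p─q⁻ E F (pick-∈ (E ─ F) pick-E─F) | i ∈? G
  ...     | i∈E , i∉F | yes i∈G = begin
    βL M′ (X ∪ G₁)                 ≡⟨ βL-pick M′ pick-E─F X∪G₁∈P′ ⟩
    𝟙 (not (lookup (X ∪ G₁) i))    ≡⟨ cong (𝟙 ∘ not) ([]=⇒lookup (q⊆p∪q X G₁ i∈G₁)) ⟩
    0ℚ                             ≡⟨ *-zeroˡ (βL (contr M G) X) ⟨
    0ℚ * βL (contr M G) X          ≡⟨ cong (λ b → 𝟙 (not b) * βL (contr M G) X) ([]=⇒lookup i∈G₁) ⟨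
    𝟙 (not (lookup G₁ i)) * βL (contr M G) X ≡⟨ cong (_* βL (contr M G) X) (βL-pick M′ pick-E─F G₁∈P′) ⟨
    βL M′ G₁ * βL (contr M G) X    ∎
    where
    i∈G₁ : i ∈ G₁
    i∈G₁ = x∈p∧x∉q⇒x∈p─q i∈G i∉F
    X∪G₁∈P′ : InP M′ (X ∪ G₁)
    X∪G₁∈P′ = C′.X∪K∈P G₁∈P′ (trans (≈M-inPᵇ M′≈ X) X∈P)
  ...     | i∈E , i∉F | no i∉G = begin
    βL M′ (X ∪ G₁)                      ≡⟨ βL-pick M′ pick-E─F X∪G₁∈P′ ⟩
    𝟙 (not (lookup (X ∪ G₁) i))         ≡⟨ cong (𝟙 ∘ not) (lookup-zipWith _∨_ i X G₁) ⟩
    𝟙 (not (lookup X i ∨ lookup G₁ i))  ≡⟨ cong (λ b → 𝟙 (not (lookup X i ∨ b))) i∉G₁ ⟩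
    𝟙 (not (lookup X i ∨ false))        ≡⟨ cong (𝟙 ∘ not) (∨-identityʳ (lookup X i)) ⟩
    𝟙 (not (lookup X i))                ≡⟨ βL-pick (contr M G) pick-E─G X∈P ⟨
    βL (contr M G) X                    ≡⟨ *-identityˡ (βL (contr M G) X) ⟨
    1ℚ * βL (contr M G) X               ≡⟨ cong (λ b → 𝟙 (not b) * βL (contr M G) X) i∉G₁ ⟨
    𝟙 (not (lookup G₁ i)) * βL (contr M G) X ≡⟨ cong (_* βL (contr M G) X) (βL-pick M′ pick-E─F G₁∈P′) ⟨
    βL M′ G₁ * βL (contr M G) X         ∎
    where
    i∉G₁ : lookup G₁ i ≡ false
    i∉G₁ = ∉⇒lookup≡false (i∉G ∘ p─q⊆p G F)
    X∪G₁∈P′ : InP M′ (X ∪ G₁)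
    X∪G₁∈P′ = C′.X∪K∈P G₁∈P′ (trans (≈M-inPᵇ M′≈ X) X∈P)
    pick-E─G : pick (E ─ G) ≡ just i
    pick-E─G = pick-⊆ (E ─ F) (E ─ G) pick-E─F
      (λ y∈ → let (y∈E , y∉G) = x∈p─q⁻ E G y∈ in x∈p∧x∉q⇒x∈p─q y∈E (y∉G ∘ F⊆G))
      (x∈p∧x∉q⇒x∈p─q i∈E i∉G)

  -- The β-terms cancel by βL-contr-∪.
  πDown-πDown : ∀ t {X} → InP (contr M G) X → πDown M′ G₁ (πDown M F t) X ≡ πDown M G t X
  πDown-πDown t {X} X∈P = begin
    πDown M′ G₁ s X
      ≡⟨ C′.πDown-coordinate G₁∈P′ X∈P′ s ⟩
    s (X ∪ G₁) - s G₁ * βL (contr M′ G₁) X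
      ≡⟨ cong₂ (λ u v → u - v * βL (contr M′ G₁) X)
           (πDown-coordinate F∈P (C′.X∪K∈P G₁∈P′ X∈P′) t) (πDown-coordinate F∈P G₁∈P′ t) ⟩
    (t ((X ∪ G₁) ∪ F) - t F * βL M′ (X ∪ G₁)) - (t (G₁ ∪ F) - t F * βL M′ G₁) * βL (contr M′ G₁) X
      ≡⟨ cong₂ (λ u v → (t u - t F * βL M′ (X ∪ G₁)) - (t v - t F * βL M′ G₁) * βL (contr M′ G₁) X)
           (r∪[q─p]∪p≡r∪q X F⊆G) (p─q∪q≡p F⊆G) ⟩
    (t (X ∪ G) - t F * βL M′ (X ∪ G₁)) - (t G - t F * βL M′ G₁) * βL (contr M′ G₁) X
      ≡⟨ cong₂ (λ u v → (t (X ∪ G) - t F * u) - (t G - t F * βL M′ G₁) * v)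
           (βL-contr-∪ X∈P) (≈M-βL M′≈ X) ⟩
    (t (X ∪ G) - t F * (βL M′ G₁ * b)) - (t G - t F * βL M′ G₁) * b
      ≡⟨ ring (t (X ∪ G)) (t F) (t G) (βL M′ G₁) b ⟩
    t (X ∪ G) - t G * b
      ≡⟨ πDown-coordinate G∈P X∈P t ⟨
    πDown M G t X ∎
    where
    s : Vect n
    s = πDown M F t
    b : ℚ
    b = βL (contr M G) X
    X∈P′ : InP (contr M′ G₁) X
    X∈P′ = trans (≈M-inPᵇ M′≈ X) X∈P
    ring : ∀ u f g β b → (u - f * (β * b)) - (g - f * β) * b ≡ u - g * b
    ring = solve-∀ ℚ-ring

-- Derivatives along a chain

Between : RawMat n → Subset n → Subset n → Set
Between M F G = IsFlat M G × F ⊂ G × G ⊂ ground M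

chainFrom-between : ∀ (M : RawMat n) {F} Fs → ChainFrom M F Fs → IsFlat M F × F ⊂ ground M × All (Between M F) Fs
chainFrom-between M [] (F-flat , F⊂E) = F-flat , F⊂E , []
chainFrom-between M (G ∷ Gs) (F-flat , F⊂G , chain) with chainFrom-between M Gs chain
... | G-flat , G⊂E , Gs-between =
  F-flat , ⊂-trans F⊂G G⊂E ,
  (G-flat , F⊂G , G⊂E) ∷ All.map (λ (H-flat , G⊂H , H⊂E) → H-flat , ⊂-trans F⊂G G⊂H , H⊂E) Gs-between

rank1 : ∀ (N : RawMat n) → Loopless N → Covers N ⊥ (ground N) → HasRank N 1
rank1 N loopless ⊥⋖E = subst (λ Z → CoverChain N Z (ground N) 1) (sym loopless) (step ⊥⋖E (here (ground N)))

module Derivatives (V : RawMat n → Poly n) (V-volume : IsVolumeFamily V)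
  (M : RawMat n) (M-matroid : IsMatroid M) (M-loopless : Loopless M) where
  open Volume V V-volume
  open Matroid M M-matroid
  open ContractionCoordinates M M-matroid M-loopless

  volume-contr-≈M : ∀ {G} → IsFlat M G → G ⊂ E → ∀ {N} → contr M G ≈M N →
    ∀ t → volume V (contr M G) t ≡ volume V N t
  volume-contr-≈M {G} G-flat G⊂E =
    volume-≈M C.isMatroid C.loopless (∈⇒≢⊥ (proj₂ (⊂⇒∃∈─ G⊂E)))
    where
    module C = Contraction G G-flat

  volume-minor-≈M : ∀ {G G′} → IsFlat M G → IsFlat M G′ → G ⊂ G′ → ∀ {N} → minor M G G′ ≈M N →
    ∀ t → volume V (minor M G G′) t ≡ volume V N t
  volume-minor-≈M {G} {G′} G-flat G′-flat G⊂G′ =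
    volume-≈M R.isMatroid (R.loopless C.loopless) (∈⇒≢⊥ (proj₂ (⊂⇒∃∈─ G⊂G′)))
    where
    module C = Contraction G G-flat
    module R = Matroid.Restriction (contr M G) C.isMatroid (G′ ─ G) (C.flat-─ G′-flat (p⊂q⇒p⊆q G⊂G′))

  module FirstStep {F} (F∈P : InP M F) where
    F-info : IsFlat M F × ⊥ ⊂ F × F ⊂ E
    F-info = InP⁻ M-loopless F∈P
    F-flat : IsFlat M F
    F-flat = proj₁ F-info
    module C = Contraction F F-flat
    M′ : RawMat n
    M′ = contr M F

    between⇒InP : ∀ {G} → Between M F G → InP M G
    between⇒InP (G-flat , F⊂G , G⊂E) = InP⁺ M-loopless G-flat (⊂-trans (proj₁ (proj₂ F-info)) F⊂G) G⊂E

    -- D_F V_M as a polynomial: V_{M^F} ∘ π^F times V_{M_F} ∘ π_F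
    P Q : Poly n
    P = pullback M (restr M F) (imgUp M F) (V (restr M F))
    Q = pullback M M′ (imgDown M F) (V M′)

    ∂F-V≈P⊗Q : ∂ F (V M) ≈[ M ] P ⊗ Q
    ∂F-V≈P⊗Q t with rank-exists M-loopless (⊂⇒≢⊥ (proj₂ (proj₂ F-info)))
    ... | r , rank = trans (volume-∂ M M-matroid M-loopless r rank F F∈P t)
      (sym (cong₂ _*_ (evalOn-pullback M (restr M F) (imgUp M F) (V (restr M F)) t)
                      (evalOn-pullback M M′ (imgDown M F) (V M′) t)))

    -- π^F kills δ_G for G ⊋ F
    ∂-P-vanishes : ∀ {G} → Between M F G → ∀ t → evalOn M (∂ G P) t ≡ 0ℚ
    ∂-P-vanishes {G} G-between@(_ , F⊂G , _) t =
      ∂-substitute-const (restrictV M t) G (linearMap M (restr M F) (imgUp M F)) ∂σ≡0 (V (restr M F))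
      where
      G⊄F : ⊊ᵇ G F ≡ false
      G⊄F = ⊄⇒⊊ᵇ≡false G F (λ G⊂F → ⊂-irref refl (⊂-trans F⊂G G⊂F))
      G≠F : eqᵇ G F ≡ false
      G≠F = ≢⇒eqᵇ≡false G F (≢-sym (⊂⇒≢ F⊂G))
      ∂σ≡0 : ∀ Y → eval (restrictV M t) (∂ G (linearMap M (restr M F) (imgUp M F) Y)) ≡ 0ℚ
      ∂σ≡0 Y rewrite ∂-linearMap M (restr M F) (imgUp M F) (restrictV M t) (between⇒InP G-between) Y
                   | G⊄F | G≠F with inPᵇ (restr M F) Y
      ... | true = refl
      ... | false = refl

    ∂-linearMap-imgDown : ∀ {G} → Between M F G → ∀ s Y →
      eval s (∂ G (linearMap M M′ (imgDown M F) Y)) ≡ 𝟙 (eqᵇ (G ─ F) Y)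
    ∂-linearMap-imgDown {G} G-between@(G-flat , F⊂G , G⊂E) s Y
      rewrite ∂-linearMap M M′ (imgDown M F) s (between⇒InP G-between) Y | ⊂⇒⊊ᵇ F G F⊂G
      with inPᵇ M′ Y in Y∈P′
    ... | true = refl
    ... | false = cong 𝟙 (sym (≢⇒eqᵇ≡false (G ─ F) Y λ G─F≡Y →
            contradiction (trans (sym (subst (InP M′) G─F≡Y (InP-─ F-flat G-flat F⊂G G⊂E))) Y∈P′) λ ()))

    foldr-∂-Q : ∀ {Gs} → All (Between M F) Gs → ∀ t →
      evalOn M (foldr ∂ Q Gs) t ≡ evalOn M′ (foldr ∂ (V M′) (map (_─ F) Gs)) (πDown M F t)
    foldr-∂-Q [] t = evalOn-pullback M M′ (imgDown M F) (V M′) t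
    foldr-∂-Q {G ∷ Gs} (G-between ∷ Gs-between) t = begin
      evalOn M (∂ G (foldr ∂ Q Gs)) t
        ≡⟨ ∂-cong M (between⇒InP G-between) (foldr ∂ Q Gs) (pullback M M′ (imgDown M F) q)
             (λ t′ → trans (foldr-∂-Q Gs-between t′) (sym (evalOn-pullback M M′ (imgDown M F) q t′))) t ⟩
      eval (restrictV M t) (∂ G (substitute q σ))
        ≡⟨ ∂-substitute-δ (restrictV M t) G (G ─ F) σ (∂-linearMap-imgDown G-between (restrictV M t)) q ⟩
      eval (λ Y → eval (restrictV M t) (σ Y)) (∂ (G ─ F) q)
        ≡⟨ eval-cong (eval-linearMap M M′ (imgDown M F) t) (∂ (G ─ F) q) ⟩
      evalOn M′ (∂ (G ─ F) q) (πDown M F t) ∎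
      where
      q : Poly n
      q = foldr ∂ (V M′) (map (_─ F) Gs)
      σ : Subset n → Poly n
      σ = linearMap M M′ (imgDown M F)

    lhs-contr : ∀ {Fs} → All (Between M F) Fs → ∀ t →
      lhs V M F Fs t ≡ volume V (restr M F) (πUp M F t) * evalOn M′ (foldr ∂ (V M′) (map (_─ F) Fs)) (πDown M F t)
    lhs-contr {Fs} Fs-between t = begin
      evalOn M (∂ F (foldr ∂ (V M) Fs)) t
        ≡⟨ ∂-foldr-comm M F Fs∈P (V M) t ⟩
      evalOn M (foldr ∂ (∂ F (V M)) Fs) t
        ≡⟨ foldr-∂-cong M Fs∈P (∂ F (V M)) (P ⊗ Q) ∂F-V≈P⊗Q t ⟩
      evalOn M (foldr ∂ (P ⊗ Q) Fs) t
        ≡⟨ foldr-∂-⊗-const M Fs∈P P Q (All.map ∂-P-vanishes Fs-between) t ⟩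
      evalOn M P t * evalOn M (foldr ∂ Q Fs) t
        ≡⟨ cong₂ _*_ (evalOn-pullback M (restr M F) (imgUp M F) (V (restr M F)) t) (foldr-∂-Q Fs-between t) ⟩
      volume V (restr M F) (πUp M F t) * evalOn M′ (foldr ∂ (V M′) (map (_─ F) Fs)) (πDown M F t) ∎
      where
      Fs∈P : All (InP M) Fs
      Fs∈P = All.map between⇒InP Fs-between

    rhsFrom-contr : ∀ {G} Gs → F ⊂ G → ChainFrom M G Gs → ∀ t →
      rhsFrom V M′ (G ─ F) (map (_─ F) Gs) (πDown M F t) ≡ rhsFrom V M G Gs t
    rhsFrom-contr {G} [] F⊂G (G-flat , G⊂E) t =
      trans (sym (volume-contr-≈M G-flat G⊂E (≈M-sym M′≈) (πDown (contr M F) (G ─ F) (πDown M F t))))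
            (evalOn-cong (contr M G) (V (contr M G)) (λ X X∈P → πDown-πDown t X∈P))
      where
      open TwoStepContraction M M-matroid M-loopless F∈P G-flat F⊂G G⊂E
      M′≈ : contr M′ (G ─ F) ≈M contr M G
      M′≈ = contr-contr M (p⊂q⇒p⊆q F⊂G) (p⊂q⇒p⊆q G⊂E)
    rhsFrom-contr {G} (G′ ∷ Gs) F⊂G chain@(G-flat , G⊂G′ , G′-chain) t =
      cong₂ _*_ first-factor (rhsFrom-contr Gs (⊂-trans F⊂G G⊂G′) G′-chain t)
      where
      G⊂E : G ⊂ ground M
      G⊂E = proj₁ (proj₂ (chainFrom-between M (G′ ∷ Gs) chain))
      G′-flat : IsFlat M G′
      G′-flat = proj₁ (chainFrom-between M Gs G′-chain)
      open TwoStepContraction M M-matroid M-loopless F∈P G-flat F⊂G G⊂E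
      M′≈ : contr M′ (G ─ F) ≈M contr M G
      M′≈ = contr-contr M (p⊂q⇒p⊆q F⊂G) (p⊂q⇒p⊆q G⊂E)
      K≡ : (G′ ─ F) ─ (G ─ F) ≡ G′ ─ G
      K≡ = r─p─[q─p]≡r─q G′ (p⊂q⇒p⊆q F⊂G)
      minor≈ : minor M G G′ ≈M minor M′ (G ─ F) (G′ ─ F)
      minor≈ = subst (λ K → minor M G G′ ≈M restr (contr M′ (G ─ F)) K) (sym K≡) (≈M-restr (≈M-sym M′≈) (G′ ─ G))
      first-factor : volume V (minor M′ (G ─ F) (G′ ─ F)) (πMid M′ (G ─ F) (G′ ─ F) (πDown M F t))
                   ≡ volume V (minor M G G′) (πMid M G G′ t)
      first-factor =
        trans (sym (volume-minor-≈M G-flat G′-flat G⊂G′ minor≈ _))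
              (evalOn-cong (minor M G G′) (V (minor M G G′)) λ X _ →
                trans (≈M-πUp M′≈ ((G′ ─ F) ─ (G ─ F)) (λ Y Y∈P → πDown-πDown t (trans (sym (≈M-inPᵇ M′≈ Y)) Y∈P)) X)
                      (cong (λ K → πUp (contr M G) K (πDown M G t) X) K≡))

    chainFrom-contr : ∀ {G} Gs → F ⊂ G → ChainFrom M G Gs → ChainFrom M′ (G ─ F) (map (_─ F) Gs)
    chainFrom-contr {G} [] F⊂G (G-flat , G⊂E) = C.flat-─ G-flat (p⊂q⇒p⊆q F⊂G) , ─-monoˡ-⊂ (p⊂q⇒p⊆q F⊂G) G⊂E
    chainFrom-contr {G} (G′ ∷ Gs) F⊂G (G-flat , G⊂G′ , G′-chain) =
      C.flat-─ G-flat (p⊂q⇒p⊆q F⊂G) , ─-monoˡ-⊂ (p⊂q⇒p⊆q F⊂G) G⊂G′ ,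
      chainFrom-contr Gs (⊂-trans F⊂G G⊂G′) G′-chain

module _ (V : RawMat n → Poly n) (V-volume : IsVolumeFamily V) where
  open Volume V V-volume

  -- Peel F₁ off the chain and recurse in M_{F₁} along F₂ ∖ F₁ ⊊ ⋯ ⊊ F_ℓ ∖ F₁.
  lhs≡rhs : ∀ (M : RawMat n) → IsMatroid M → Loopless M → ∀ F Fs → IsChain M F Fs →
    ∀ t → lhs V M F Fs t ≡ rhs V M F Fs t
  lhs≡rhs M M-matroid M-loopless F Fs = go (length Fs) M M-matroid M-loopless F Fs refl
    where
    go : ∀ k M → IsMatroid M → Loopless M → ∀ F Fs → length Fs ≡ k → IsChain M F Fs →
      ∀ t → lhs V M F Fs t ≡ rhs V M F Fs t
    go k M M-matroid M-loopless F Fs len (0⊂F , F-chain) t =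
      trans (lhs-contr (proj₂ (proj₂ F-between)) t) (cong (volume V (restr M F) (πUp M F t) *_) (tail k Fs len F-chain))
      where
      F-between : IsFlat M F × F ⊂ ground M × All (Between M F) Fs
      F-between = chainFrom-between M Fs F-chain
      F∈P : InP M F
      F∈P = Matroid.InP⁺ M M-matroid M-loopless (proj₁ F-between) (subst (_⊂ F) M-loopless 0⊂F) (proj₁ (proj₂ F-between))
      open Derivatives V V-volume M M-matroid M-loopless
      open FirstStep F∈P
      tail : ∀ k Fs → length Fs ≡ k → ChainFrom M F Fs →
        evalOn M′ (foldr ∂ (V M′) (map (_─ F) Fs)) (πDown M F t) ≡ rhsFrom V M F Fs t
      tail _ [] _ _ = refl
      tail (suc k) (F₂ ∷ Fs) len (_ , F⊂F₂ , F₂-chain) =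
        trans (go k M′ C.isMatroid C.loopless (F₂ ─ F) (map (_─ F) Fs)
                  (trans (length-map (_─ F) Fs) (ℕ.suc-injective len)) M′-chain (πDown M F t))
              (cong (volume V (minor M F F₂) (πMid M F F₂ t) *_) (rhsFrom-contr Fs F⊂F₂ F₂-chain t))
        where
        M′-chain : IsChain M′ (F₂ ─ F) (map (_─ F) Fs)
        M′-chain = subst (_⊂ F₂ ─ F) (sym C.loopless) (⊆∧≢⇒⊂ ⊥⊆ (≢-sym (∈⇒≢⊥ (proj₂ (⊂⇒∃∈─ F⊂F₂))))) ,
                   chainFrom-contr Fs F⊂F₂ F₂-chain

  -- Along a maximal chain every minor has rank 1.
  rhs≡1 : ∀ (M : RawMat n) → IsMatroid M → Loopless M → ∀ F Fs → IsMaximalChain M F Fs →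
    ∀ t → rhs V M F Fs t ≡ 1ℚ
  rhs≡1 M M-matroid M-loopless F Fs (0⋖F , F-maximal) t =
    trans (cong₂ _*_ first-factor (rhsFrom≡1 Fs F-flat F-maximal)) (*-identityˡ 1ℚ)
    where
    open Matroid M M-matroid
    ⊥⋖F : Covers M ⊥ F
    ⊥⋖F = subst (λ Z → Covers M Z F) M-loopless 0⋖F
    F-flat : IsFlat M F
    F-flat = proj₁ ⊥⋖F
    module R = Restriction F F-flat
    first-factor : volume V (restr M F) (πUp M F t) ≡ 1ℚ
    first-factor = volume-rank1 (restr M F) R.isMatroid (R.loopless M-loopless)
      (rank1 (restr M F) (R.loopless M-loopless) (R.covers⁺ ⊆-refl ⊥⋖F)) (πUp M F t)
    rhsFrom≡1 : ∀ {G} Gs → IsFlat M G → MaxFrom M G Gs → rhsFrom V M G Gs t ≡ 1ℚ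
    rhsFrom≡1 {G} [] G-flat G⋖E =
      volume-rank1 (contr M G) C.isMatroid C.loopless (rank1 (contr M G) C.loopless (C.covers-⊥ G⋖E)) (πDown M G t)
      where
      module C = Contraction G G-flat
    rhsFrom≡1 {G} (G′ ∷ Gs) G-flat (G⋖G′ , G′-maximal) =
      trans (cong₂ _*_ minor-volume (rhsFrom≡1 Gs (proj₁ G⋖G′) G′-maximal)) (*-identityˡ 1ℚ)
      where
      module C = Contraction G G-flat
      module R′ = Matroid.Restriction (contr M G) C.isMatroid (G′ ─ G) (proj₁ (C.covers-⊥ G⋖G′))
      minor-volume : volume V (minor M G G′) (πMid M G G′ t) ≡ 1ℚ
      minor-volume = volume-rank1 (minor M G G′) R′.isMatroid (R′.loopless C.loopless)
        (rank1 (minor M G G′) (R′.loopless C.loopless) (R′.covers⁺ ⊆-refl (C.covers-⊥ G⋖G′))) (πMid M G G′ t)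

mainTheorem11 : ∀ (n : ℕ) (V : RawMat n → Poly n) → IsVolumeFamily V →
    ∀ (M : RawMat n) → IsMatroid M → Loopless M →
    ∀ (r : ℕ) → HasRank M (suc r) →
    ∀ (F : Subset n) (Fs : List (Subset n)) → IsChain M F Fs →
    (∀ (t : Vect n) → lhs V M F Fs t ≡ rhs V M F Fs t)
    × (IsMaximalChain M F Fs → ∀ (t : Vect n) → lhs V M F Fs t ≡ 1ℚ)
mainTheorem11 n V V-volume M M-matroid M-loopless _ _ F Fs chain =
  lhs≡rhs V V-volume M M-matroid M-loopless F Fs chain ,
  λ maximal t → trans (lhs≡rhs V V-volume M M-matroid M-loopless F Fs chain t)
                      (rhs≡1 V V-volume M M-matroid M-loopless F Fs maximal t)
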